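{- Let $G$ be a maze, i.e. a finite connected planar graph embedded in the plane, with maximum degree at most three, together with three distinct vertices $A$, $B$, $C$ of degree one lying on the outer boundary. Run the probabilistic depth-first search (PDFS) on $G$ starting at $A$, with independent fair coin flips. Then the probability that $B$ is reached before $C$ and the probability that $C$ is reached before $B$ are both equal to $\tfrac12$. In other words, in PDFS the probabilities of exiting at $B$ and at $C$ are both $\tfrac12$.
   Context: Interpretation: vertices are "rooms" and edges are "doors". The vertex $A$ is the entrance, and $B$, $C$ are the two exits. (Concretely, a maze can be pictured as an $m\times n$ grid rectangle with some unit edges being walls; the boundary is walled except at three boundary edges $A,B,C$ in counterclockwise order, and two adjacent unit squares are joined by a door when no wall separates them.) Depth-first exploration. For the exploration, pretend that the exits are closed: the walker traverses the whole graph, passing through every door exactly twice (once in each direction), and returns to $A$. The walker starts at $A$ and walks through its unique door. The walker always remembers which doors it has already passed through. On arriving at a room $v$ through a door $e$, it acts as follows. - If $v$ was visited before, and it arrived through a door not previously used, it immediately goes back through $e$. - If this is the first visit to $v$, then $e$ becomes the entry door of $v$, and the walker next tries the other doors of $v$: - if $v$ has one door, it goes back through $e$; - if $v$ has two doors, it goes through the other door; - if $v$ has three doors, it must choose which of the two other doors to take first. - Whenever the walker is at $v$ after returning from a previously chosen door, it takes a door of $v$ that has not yet been passed through in either direction, if one exists. Otherwise it leaves $v$ through its entry door. The exploration ends when the walker returns to $A$ and all doors have been used. In the (right) depth-first search, the choice at a three-door room is always the door on the right relative to the entry door, in the planar embedding. The probabilistic depth-first search (PDFS) instead flips an independent fair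 coin the first time each three-door room is entered. On Heads it takes the door on the right of the entry door first; on Tails it takes the door on the left first. Exiting. The walk is said to exit at $B$ if $B$ is visited before $C$, and to exit at $C$ otherwise. -}

module Defs where

open import Data.Nat using (ℕ; zero; suc; _+_; _*_; _^_; _≤ᵇ_)
open import Data.Fin using (Fin; toℕ)
open import Data.Fin.Properties using (_≟_)
open import Data.Bool using (Bool; true; false; if_then_else_; not; _∨_)
open import Data.Maybe using (Maybe; just; nothing)
open import Data.List using (List; []; _∷_; length; filterᵇ; allFin; map; _++_)
open import Data.Bool.ListAction using (all; any)
open import Data.Vec using (Vec; []; _∷_; lookup)
open import Data.Product using (Σ; ∃; ∃-syntax; _×_; _,_; proj₁)
open import Data.Sum using (_⊎_)
open import Relation.Binary.PropositionalEquality using (_≡_; _≢_)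
open import Relation.Nullary.Decidable using (⌊_⌋)

iter : {X : Set} → (X → X) → ℕ → X → X
iter f zero x = x
iter f (suc k) x = f (iter f k x)

isOrbitMin : (d : ℕ) → (Fin d → Fin d) → Fin d → Bool
isOrbitMin d f x = all (λ k → toℕ x ≤ᵇ toℕ (iter f (toℕ k) x)) (allFin d)

numOrbits : (d : ℕ) → (Fin d → Fin d) → ℕ
numOrbits d f = length (filterᵇ (isOrbitMin d f) (allFin d))

-- connectivity in the graph whose darts (half-edges) are Fin d,
-- dart x starting at vertex org x, with opposite dart α x
data Reach {n d : ℕ} (org : Fin d → Fin n) (α : Fin d → Fin d) :
           Fin n → Fin n → Set where
  here : ∀ {u} → Reach org α u u
  step : ∀ {u v} (x : Fin d) → org x ≡ u → Reach org α (org (α x)) v →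
         Reach org α u v

-- Finite simple connected plane graph of maximum degree ≤ 3,
-- given combinatorially as a rotation system (combinatorial map):
--   darts Fin d, edge involution α (fixed-point free),
--   σ = counterclockwise successor of a dart around its origin vertex,
--   faces = cycles of φ = σ ∘ α, planarity = Euler's formula V - E + F = 2.

record PlaneGraph : Set where
  field
    n d     : ℕ
    org     : Fin d → Fin n
    α σ σ⁻¹ : Fin d → Fin d
    α-invol : ∀ x → α (α x) ≡ x
    α-nofix : ∀ x → α x ≢ x
    σ-inv₁  : ∀ x → σ (σ⁻¹ x) ≡ x
    σ-inv₂  : ∀ x → σ⁻¹ (σ x) ≡ x
    σ-org   : ∀ x → org (σ x) ≡ org x
    σ-cyc   : ∀ x y → org x ≡ org y → ∃[ k ] iter σ k x ≡ y
    org-surj : ∀ v → ∃[ x ] org x ≡ v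
    no-loop  : ∀ x → org (α x) ≢ org x
    no-multi : ∀ x y → org x ≡ org y → org (α x) ≡ org (α y) → x ≡ y
    deg≤3    : ∀ x → σ x ≡ x ⊎ σ (σ x) ≡ x ⊎ σ (σ (σ x)) ≡ x
    connected : ∀ u v → Reach org α u v
    -- Euler: V - E + F = 2 with E = d/2, i.e. 2V + 2F = 4 + d
    euler    : 2 * n + 2 * numOrbits d (λ x → σ (α x)) ≡ 4 + d

open PlaneGraph public

φ : (G : PlaneGraph) → Fin (d G) → Fin (d G)
φ G x = σ G (α G x)

DegOne : (G : PlaneGraph) → Fin (n G) → Set
DegOne G v = ∀ x → org G x ≡ v → σ G x ≡ x

-- Entrance A and exits B, C: distinct degree-one vertices all lying on
-- the boundary of one common face (taken as the outer face).
record Terminals (G : PlaneGraph) : Set where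
  field
    A B C : Fin (n G)
    A≢B : A ≢ B
    A≢C : A ≢ C
    B≢C : B ≢ C
    degA : DegOne G A
    degB : DegOne G B
    degC : DegOne G C
    outer : ∃[ a ] ∃[ b ] ∃[ c ]
              (org G a ≡ A × org G b ≡ B × org G c ≡ C ×
               (∃[ k ] iter (φ G) k a ≡ b) × (∃[ k ] iter (φ G) k a ≡ c))

open Terminals public

-- The probabilistic depth-first search, driven by a coin for every room
-- (only used at three-door rooms, at their first visit).

data Exit : Set where
  exitB exitC : Exit

module _ (G : PlaneGraph) (T : Terminals G) (coin : Fin (n G) → Bool) where

  private
    Dart = Fin (d G)
    V    = Fin (n G)

  memD : Dart → List Dart → Bool
  memD x xs = any (λ z → ⌊ z ≟ x ⌋) xs

  memV : V → List V → Bool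
  memV v vs = any (λ w → ⌊ w ≟ v ⌋) vs

  doorUsed : List Dart → Dart → Bool
  doorUsed cr x = memD x cr ∨ memD (α G x) cr

  -- run fuel crossed visited entry x :
  --   the walker now crosses dart x, i.e. walks from org x through the door
  --   {x, α x} into room org (α x).  'crossed' = darts already crossed,
  --   'entry v' = dart at v of the entry door of v.
  -- Returns the first of B, C reached (nothing if the walk ends / fuel runs out).
  run : ℕ → List Dart → List V → (V → Maybe Dart) → Dart → Maybe Exit
  run zero cr vis ent x = nothing
  run (suc k) cr vis ent x =
    if ⌊ v ≟ B T ⌋ then just exitB else
    if ⌊ v ≟ C T ⌋ then just exitC else
    if memV v vis
      then (if fresh then run k cr' vis ent y else back (ent v))
      else first
    where
      y     = α G x
      v     = org G y
      fresh = not (doorUsed cr x)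
      cr'   = x ∷ cr
      back : Maybe Dart → Maybe Exit
      back nothing  = nothing
      back (just e) =
        if not (doorUsed cr' (σ G e)) then run k cr' vis ent (σ G e) else
        if not (doorUsed cr' (σ G (σ G e))) then run k cr' vis ent (σ G (σ G e))
        else run k cr' vis ent e
      vis' = v ∷ vis
      ent' : V → Maybe Dart
      ent' w = if ⌊ w ≟ v ⌋ then just y else ent w
      -- first visit: y is the entry dart; σ y = door on the right
      first : Maybe Exit
      first =
        if ⌊ σ G y ≟ y ⌋ then run k cr' vis' ent' y else
        if ⌊ σ G (σ G y) ≟ y ⌋ then run k cr' vis' ent' (σ G y) else
        if coin v then run k cr' vis' ent' (σ G y)
                  else run k cr' vis' ent' (σ G (σ G y))

  -- the whole walk: start at A, go through its unique door
  -- (fuel 2d+2 exceeds the total number 2E = d of door passages)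
  pdfsExit : Maybe Exit
  pdfsExit = run (2 * d G + 2) [] (A T ∷ []) (λ _ → nothing)
                 (proj₁ (org-surj G (A T)))

-- all coin assignments (uniform product measure)
allCoins : (m : ℕ) → List (Vec Bool m)
allCoins zero = [] ∷ []
allCoins (suc m) = map (true ∷_) (allCoins m) ++ map (false ∷_) (allCoins m)

isExit : Exit → Maybe Exit → Bool
isExit exitB (just exitB) = true
isExit exitC (just exitC) = true
isExit _ _ = false

countExit : (G : PlaneGraph) → Terminals G → Exit → ℕ
countExit G T e =
  length (filterᵇ (λ cs → isExit e (pdfsExit G T (lookup cs))) (allCoins (n G)))

-- Call a room separating when the walker enters it for the first time, it has three doors,
-- and, avoiding the rooms visited so far, one of its two other doors leads to exactly one of
-- B and C while the other door leads to the other exit. Depth-first search explores everything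
-- reachable beyond a door before using the next one, so as long as no separating room has been
-- entered both exits remain reachable without revisiting; an exit being a dead end, the walker
-- is at neither, and it must eventually enter a separating room s. There the coin of s chooses
-- which branch is explored first, and this alone decides the exit. The walk up to s never
-- tosses the coin of s, so flipping that coin keeps s and swaps the exit: c ↦ flip (s c) c is
-- an involution on coin vectors exchanging the exits. The argument does not use planarity.

module Submission where

open import Defs
open import Data.Nat using (ℕ; zero; suc; _+_; _*_; _^_; _≤_; _<_; z≤n; s≤s) renaming (_≟_ to _≟ℕ_)
open import Data.Nat.Properties
  using (+-commutativeSemigroup; ≤-trans; ≤-refl; <-≤-trans; n≤1+n; m≤m+n; +-mono-≤; +-suc; <⇒≤; ≤-pred; +-assoc; +-comm; +-identityʳ)
open import Data.Fin using (Fin; zero; suc)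
open import Data.Fin.Properties using (_≟_; suc-injective)
open import Data.Bool using (Bool; true; false; if_then_else_; not; _∨_; _∧_)
open import Data.Bool.Properties using (∨-comm; ∨-conicalˡ; ∨-conicalʳ; not-involutive; ¬-not)
open import Data.Bool.ListAction using (any)
open import Data.Maybe using (Maybe; just; nothing)
open import Data.List using (List; []; _∷_; _++_; length; filterᵇ; map; allFin)
open import Data.List.Properties using (++-assoc; length-++; length-map)
open import Data.List.Relation.Unary.All using (All; []; _∷_)
import Data.List.Relation.Unary.All as All
import Data.List.Relation.Unary.Any as Any
open import Data.List.Membership.Propositional using (_∈_)
open import Data.List.Membership.Propositional.Properties using (∈-map⁺; ∈-++⁺ˡ; ∈-++⁺ʳ; ∈-allFin)
open import Data.List.Relation.Unary.All.Properties using (++⁺)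
open import Data.Vec using (Vec; []; _∷_; lookup; updateAt; tabulate)
open import Data.Vec.Properties using (lookup∘tabulate; lookup∘updateAt; lookup∘updateAt′; updateAt-updateAt-local; updateAt-id)
open import Data.Product using (Σ; ∃-syntax; Σ-syntax; _×_; _,_; proj₁; proj₂)
open import Data.Sum using (_⊎_; inj₁; inj₂; [_,_]′)
open import Data.Empty using (⊥; ⊥-elim)
open import Relation.Nullary using (¬_; Dec; yes; no)
open import Relation.Nullary.Decidable using (⌊_⌋; toSum; ¬?; _×-dec_; _⊎-dec_; map′; ¬¬-excluded-middle; decidable-stable)
open import Relation.Nullary.Negation using (¬¬-map)
open import Relation.Binary.PropositionalEquality
open import Function using (_∘_; id)
open import Algebra.Properties.CommutativeSemigroup +-commutativeSemigroup using (interchange)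

≡true⇒≢false : ∀ {b} → b ≡ true → b ≢ false
≡true⇒≢false refl ()

contraposeᵇ : ∀ {a b} → (a ≡ true → b ≡ true) → b ≡ false → a ≡ false
contraposeᵇ {false} _ _ = refl
contraposeᵇ {true} a⇒b b≡false = ⊥-elim (≡true⇒≢false (a⇒b refl) b≡false)

∨-true⁻ : ∀ {a b} → a ∨ b ≡ true → a ≡ true ⊎ b ≡ true
∨-true⁻ {true} _ = inj₁ refl
∨-true⁻ {false} b≡true = inj₂ b≡true

∨-true⁺ˡ : ∀ {a b} → a ≡ true → a ∨ b ≡ true
∨-true⁺ˡ refl = refl

∨-true⁺ʳ : ∀ {a b} → b ≡ true → a ∨ b ≡ true
∨-true⁺ʳ {true} _ = refl
∨-true⁺ʳ {false} b≡true = b≡true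

∨-false⁺ : ∀ {a b} → a ≡ false → b ≡ false → a ∨ b ≡ false
∨-false⁺ refl refl = refl

true-or-false : ∀ b → b ≡ true ⊎ b ≡ false
true-or-false true = inj₁ refl
true-or-false false = inj₂ refl

not-true⁻ : ∀ {b} → not b ≡ true → b ≡ false
not-true⁻ {false} _ = refl

not-true⁺ : ∀ {b} → b ≡ false → not b ≡ true
not-true⁺ refl = refl

⌊⌋-true : ∀ {P : Set} (p? : Dec P) → P → ⌊ p? ⌋ ≡ true
⌊⌋-true (yes _) _ = refl
⌊⌋-true (no ¬p) p = ⊥-elim (¬p p)

⌊⌋-false : ∀ {P : Set} (p? : Dec P) → ¬ P → ⌊ p? ⌋ ≡ false
⌊⌋-false (yes p) ¬p = ⊥-elim (¬p p)
⌊⌋-false (no _) _ = refl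

⌊⌋-true⁻ : ∀ {P : Set} (p? : Dec P) → ⌊ p? ⌋ ≡ true → P
⌊⌋-true⁻ (yes p) _ = p

⌊⌋-false⁻ : ∀ {P : Set} (p? : Dec P) → ⌊ p? ⌋ ≡ false → ¬ P
⌊⌋-false⁻ (no ¬p) _ = ¬p

-- Boolean membership, in the form the walker of Defs tests it
module _ {m : ℕ} where

  infix 5 _∈ᵇ_

  _∈ᵇ_ : Fin m → List (Fin m) → Bool
  x ∈ᵇ xs = any (λ z → ⌊ z ≟ x ⌋) xs

  ∈ᵇ-here : ∀ x xs → x ∈ᵇ (x ∷ xs) ≡ true
  ∈ᵇ-here x xs = ∨-true⁺ˡ (⌊⌋-true (x ≟ x) refl)

  ∈ᵇ-there : ∀ x y xs → x ∈ᵇ xs ≡ true → x ∈ᵇ (y ∷ xs) ≡ true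
  ∈ᵇ-there x y xs = ∨-true⁺ʳ {⌊ y ≟ x ⌋}

  ∉ᵇ-∷ : ∀ x y xs → y ≢ x → x ∈ᵇ xs ≡ false → x ∈ᵇ (y ∷ xs) ≡ false
  ∉ᵇ-∷ x y xs y≢x = ∨-false⁺ (⌊⌋-false (y ≟ x) y≢x)

  ∈ᵇ-∷⁻ : ∀ x y xs → x ∈ᵇ (y ∷ xs) ≡ true → y ≡ x ⊎ x ∈ᵇ xs ≡ true
  ∈ᵇ-∷⁻ x y xs x∈ with ∨-true⁻ {⌊ y ≟ x ⌋} x∈
  ... | inj₁ y≟x = inj₁ (⌊⌋-true⁻ (y ≟ x) y≟x)
  ... | inj₂ x∈xs = inj₂ x∈xs

  ∈ᵇ-++⁺ʳ : ∀ x ys xs → x ∈ᵇ xs ≡ true → x ∈ᵇ (ys ++ xs) ≡ true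
  ∈ᵇ-++⁺ʳ x [] xs x∈xs = x∈xs
  ∈ᵇ-++⁺ʳ x (y ∷ ys) xs x∈xs = ∈ᵇ-there x y (ys ++ xs) (∈ᵇ-++⁺ʳ x ys xs x∈xs)

  ∈ᵇ-++⁻ : ∀ x ys xs → x ∈ᵇ (ys ++ xs) ≡ true → x ∈ᵇ ys ≡ true ⊎ x ∈ᵇ xs ≡ true
  ∈ᵇ-++⁻ x [] xs x∈ = inj₂ x∈
  ∈ᵇ-++⁻ x (y ∷ ys) xs x∈ with ∈ᵇ-∷⁻ x y (ys ++ xs) x∈
  ... | inj₁ refl = inj₁ (∈ᵇ-here x ys)
  ... | inj₂ x∈′ with ∈ᵇ-++⁻ x ys xs x∈′
  ...   | inj₁ x∈ys = inj₁ (∈ᵇ-there x y ys x∈ys)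
  ...   | inj₂ x∈xs = inj₂ x∈xs

  ∉ᵇ-++ : ∀ x ys xs → x ∈ᵇ ys ≡ false → x ∈ᵇ xs ≡ false → x ∈ᵇ (ys ++ xs) ≡ false
  ∉ᵇ-++ x [] xs _ x∉xs = x∉xs
  ∉ᵇ-++ x (y ∷ ys) xs x∉ x∉xs =
    ∨-false⁺ (∨-conicalˡ _ _ x∉) (∉ᵇ-++ x ys xs (∨-conicalʳ _ _ x∉) x∉xs)

  ∈ᵇ-All : ∀ {Q : Fin m → Set} x ys → All Q ys → x ∈ᵇ ys ≡ true → Q x
  ∈ᵇ-All x (y ∷ ys) (q ∷ qs) x∈ with ∈ᵇ-∷⁻ x y ys x∈
  ... | inj₁ refl = q
  ... | inj₂ x∈ys = ∈ᵇ-All x ys qs x∈ys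

  ∉ᵇ-All : ∀ {Q : Fin m → Set} x ys → All Q ys → ¬ Q x → x ∈ᵇ ys ≡ false
  ∉ᵇ-All x ys qs ¬Qx = ¬-not (¬Qx ∘ ∈ᵇ-All x ys qs)

fromBool : Bool → ℕ
fromBool true = 1
fromBool false = 0

sumBy : ∀ {A : Set} → (A → ℕ) → List A → ℕ
sumBy f [] = 0
sumBy f (a ∷ as) = f a + sumBy f as

sumBy-cong : ∀ {A : Set} {f g : A → ℕ} xs → (∀ a → f a ≡ g a) → sumBy f xs ≡ sumBy g xs
sumBy-cong [] f≗g = refl
sumBy-cong (a ∷ as) f≗g = cong₂ _+_ (f≗g a) (sumBy-cong as f≗g)

sumBy-+ : ∀ {A : Set} (f g : A → ℕ) xs → sumBy (λ a → f a + g a) xs ≡ sumBy f xs + sumBy g xs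
sumBy-+ f g [] = refl
sumBy-+ f g (a ∷ as) =
  trans (cong (f a + g a +_) (sumBy-+ f g as)) (interchange (f a) (g a) (sumBy f as) (sumBy g as))

sumBy-++ : ∀ {A : Set} (f : A → ℕ) xs ys → sumBy f (xs ++ ys) ≡ sumBy f xs + sumBy f ys
sumBy-++ f [] ys = refl
sumBy-++ f (x ∷ xs) ys = trans (cong (f x +_) (sumBy-++ f xs ys)) (sym (+-assoc (f x) (sumBy f xs) (sumBy f ys)))

sumBy-map : ∀ {A B : Set} (f : B → ℕ) (g : A → B) xs → sumBy f (map g xs) ≡ sumBy (λ a → f (g a)) xs
sumBy-map f g [] = refl
sumBy-map f g (x ∷ xs) = cong (f (g x) +_) (sumBy-map f g xs)

sumBy-const1 : ∀ {A : Set} (xs : List A) → sumBy (λ _ → 1) xs ≡ length xs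
sumBy-const1 [] = refl
sumBy-const1 (a ∷ as) = cong suc (sumBy-const1 as)

length-filterᵇ : ∀ {A : Set} (p : A → Bool) xs → length (filterᵇ p xs) ≡ sumBy (λ a → fromBool (p a)) xs
length-filterᵇ p [] = refl
length-filterᵇ p (x ∷ xs) with p x
... | true = cong suc (length-filterᵇ p xs)
... | false = length-filterᵇ p xs

∑ : ∀ {m} → (Fin m → ℕ) → ℕ
∑ {zero} f = 0
∑ {suc m} f = f zero + ∑ (λ i → f (suc i))

∑-cong : ∀ {m} {f g : Fin m → ℕ} → (∀ i → f i ≡ g i) → ∑ f ≡ ∑ g
∑-cong {zero} f≗g = refl
∑-cong {suc m} f≗g = cong₂ _+_ (f≗g zero) (∑-cong (λ i → f≗g (suc i)))

∑-+ : ∀ {m} (f g : Fin m → ℕ) → ∑ (λ i → f i + g i) ≡ ∑ f + ∑ g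
∑-+ {zero} f g = refl
∑-+ {suc m} f g =
  trans (cong (f zero + g zero +_) (∑-+ (λ i → f (suc i)) (λ i → g (suc i))))
        (interchange (f zero) (g zero) _ _)

∑-zero : ∀ {m} (f : Fin m → ℕ) → (∀ i → f i ≡ 0) → ∑ f ≡ 0
∑-zero {zero} f f≗0 = refl
∑-zero {suc m} f f≗0 = cong₂ _+_ (f≗0 zero) (∑-zero (λ i → f (suc i)) (λ i → f≗0 (suc i)))

∑-single : ∀ {m} (f : Fin m → ℕ) j → (∀ i → i ≢ j → f i ≡ 0) → ∑ f ≡ f j
∑-single {suc m} f zero f≗0 =
  trans (cong (f zero +_) (∑-zero (λ i → f (suc i)) (λ i → f≗0 (suc i) λ ()))) (+-identityʳ _)
∑-single {suc m} f (suc j) f≗0 =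
  cong₂ _+_ (f≗0 zero λ ()) (∑-single (λ i → f (suc i)) j (λ i i≢j → f≗0 (suc i) (i≢j ∘ suc-injective)))

sumBy-∑-comm : ∀ {A : Set} {m} (h : A → Fin m → ℕ) xs →
               sumBy (λ a → ∑ (h a)) xs ≡ ∑ (λ i → sumBy (λ a → h a i) xs)
sumBy-∑-comm {m = m} h [] = sym (∑-zero {m} (λ _ → 0) (λ _ → refl))
sumBy-∑-comm h (a ∷ as) =
  trans (cong (∑ (h a) +_) (sumBy-∑-comm h as)) (sym (∑-+ (h a) (λ i → sumBy (λ b → h b i) as)))

flipAt : ∀ {m} → Fin m → Vec Bool m → Vec Bool m
flipAt v c = updateAt c v not

flipAt-involutive : ∀ {m} (v : Fin m) c → flipAt v (flipAt v c) ≡ c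
flipAt-involutive v c =
  trans (updateAt-updateAt-local v {not} {not} {λ b → b} c (not-involutive (lookup c v))) (updateAt-id v c)

sumBy-allCoins : ∀ {m} (g : Vec Bool (suc m) → ℕ) →
                 sumBy g (allCoins (suc m)) ≡
                 sumBy (λ c → g (true ∷ c)) (allCoins m) + sumBy (λ c → g (false ∷ c)) (allCoins m)
sumBy-allCoins {m} g =
  trans (sumBy-++ g (map (true ∷_) (allCoins m)) (map (false ∷_) (allCoins m)))
        (cong₂ _+_ (sumBy-map g (true ∷_) (allCoins m)) (sumBy-map g (false ∷_) (allCoins m)))

sumBy-flipAt : ∀ {m} (v : Fin m) (g : Vec Bool m → ℕ) →
               sumBy (λ c → g (flipAt v c)) (allCoins m) ≡ sumBy g (allCoins m)
sumBy-flipAt zero g =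
  trans (sumBy-allCoins (λ c → g (flipAt zero c))) (trans (+-comm (sumBy (λ c → g (false ∷ c)) (allCoins _)) _) (sym (sumBy-allCoins g)))
sumBy-flipAt (suc v) g =
  trans (sumBy-allCoins (λ c → g (flipAt (suc v) c)))
        (trans (cong₂ _+_ (sumBy-flipAt v (λ c → g (true ∷ c))) (sumBy-flipAt v (λ c → g (false ∷ c))))
               (sym (sumBy-allCoins g)))

length-allCoins : ∀ m → length (allCoins m) ≡ 2 ^ m
length-allCoins zero = refl
length-allCoins (suc m) = begin
  length (map (true ∷_) (allCoins m) ++ map (false ∷_) (allCoins m))
    ≡⟨ length-++ (map (true ∷_) (allCoins m)) ⟩
  length (map (true ∷_) (allCoins m)) + length (map (false ∷_) (allCoins m))
    ≡⟨ cong₂ _+_ (length-map (true ∷_) (allCoins m)) (length-map (false ∷_) (allCoins m)) ⟩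
  length (allCoins m) + length (allCoins m)
    ≡⟨ cong₂ _+_ (length-allCoins m) (trans (length-allCoins m) (sym (+-identityʳ _))) ⟩
  2 ^ suc m ∎
  where open ≡-Reasoning

countCoins : ∀ m → (Vec Bool m → Bool) → ℕ
countCoins m p = length (filterᵇ p (allCoins m))

complementary-counts : ∀ m (p q : Vec Bool m → Bool) → (∀ c → p c ≡ not (q c)) → countCoins m p + countCoins m q ≡ 2 ^ m
complementary-counts m p q p≡¬q = begin
  countCoins m p + countCoins m q                              ≡⟨ cong₂ _+_ (length-filterᵇ p L) (length-filterᵇ q L) ⟩
  sumBy (λ c → fromBool (p c)) L + sumBy (λ c → fromBool (q c)) L ≡⟨ sumBy-+ _ _ L ⟨
  sumBy (λ c → fromBool (p c) + fromBool (q c)) L              ≡⟨ sumBy-cong L one-of-two ⟩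
  sumBy (λ _ → 1) L                                            ≡⟨ sumBy-const1 L ⟩
  length L                                                     ≡⟨ length-allCoins m ⟩
  2 ^ m                                                        ∎
  where
  open ≡-Reasoning
  L : List (Vec Bool m)
  L = allCoins m
  one-of-two : ∀ c → fromBool (p c) + fromBool (q c) ≡ 1
  one-of-two c rewrite p≡¬q c with q c
  ... | true = refl
  ... | false = refl

-- c ↦ flipAt (s c) c is an involution; it is counted fibrewise over s, where it is the
-- bijection flipAt v of all coin vectors.
module _ {m : ℕ} (s : Vec Bool m → Fin m) (s-flip : ∀ c → s (flipAt (s c) c) ≡ s c) where

  private
    L : List (Vec Bool m)
    L = allCoins m

    fibre : (Vec Bool m → Bool) → Vec Bool m → Fin m → ℕ
    fibre p c v = fromBool (⌊ s c ≟ v ⌋ ∧ p c)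

    fibre-off : ∀ p c v → s c ≢ v → fibre p c v ≡ 0
    fibre-off p c v sc≢v rewrite ⌊⌋-false (s c ≟ v) sc≢v = refl

    count-by-fibres : ∀ p → countCoins m p ≡ ∑ (λ v → sumBy (λ c → fibre p c v) L)
    count-by-fibres p = begin
      length (filterᵇ p L)                       ≡⟨ length-filterᵇ p L ⟩
      sumBy (λ c → fromBool (p c)) L             ≡⟨ sumBy-cong L on-fibre ⟩
      sumBy (λ c → ∑ (fibre p c)) L              ≡⟨ sumBy-∑-comm (fibre p) L ⟩
      ∑ (λ v → sumBy (λ c → fibre p c v) L)      ∎
      where
      open ≡-Reasoning
      on-fibre : ∀ c → fromBool (p c) ≡ ∑ (fibre p c)
      on-fibre c rewrite ∑-single (fibre p c) (s c) (λ v v≢sc → fibre-off p c v (v≢sc ∘ sym))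
                       | ⌊⌋-true (s c ≟ s c) refl = refl

    flip-leaves-fibre : ∀ v c → s c ≢ v → s (flipAt v c) ≢ v
    flip-leaves-fibre v c sc≢v sfc≡v = sc≢v (begin
      s c                                       ≡⟨ cong s (sym (flipAt-involutive v c)) ⟩
      s (flipAt v (flipAt v c))                 ≡⟨ cong (λ u → s (flipAt u (flipAt v c))) (sym sfc≡v) ⟩
      s (flipAt (s (flipAt v c)) (flipAt v c))  ≡⟨ s-flip (flipAt v c) ⟩
      s (flipAt v c)                            ≡⟨ sfc≡v ⟩
      v                                         ∎)
      where open ≡-Reasoning

  flip-swapped-counts : ∀ p q → (∀ c → p (flipAt (s c) c) ≡ q c) → countCoins m p ≡ countCoins m q
  flip-swapped-counts p q swap = begin
    countCoins m p                                    ≡⟨ count-by-fibres p ⟩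
    ∑ (λ v → sumBy (λ c → fibre p c v) L)             ≡⟨ ∑-cong (λ v → sym (sumBy-flipAt v (λ c → fibre p c v))) ⟩
    ∑ (λ v → sumBy (λ c → fibre p (flipAt v c) v) L)  ≡⟨ ∑-cong (λ v → sumBy-cong L (fibre-swap v)) ⟩
    ∑ (λ v → sumBy (λ c → fibre q c v) L)             ≡⟨ count-by-fibres q ⟨
    countCoins m q                                    ∎
    where
    open ≡-Reasoning
    fibre-swap : ∀ v c → fibre p (flipAt v c) v ≡ fibre q c v
    fibre-swap v c with s c ≟ v
    ... | yes refl rewrite s-flip c | swap c | ⌊⌋-true (s c ≟ s c) refl = refl
    ... | no sc≢v = fibre-off p (flipAt v c) v (flip-leaves-fibre v c sc≢v)

decisive-coin-halves : ∀ m (s : Vec Bool m → Fin m) (pB pC : Vec Bool m → Bool) →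
  (∀ c → s (flipAt (s c) c) ≡ s c) → (∀ c → pB (flipAt (s c) c) ≡ pC c) → (∀ c → pB c ≡ not (pC c)) →
  2 * countCoins m pB ≡ 2 ^ m × 2 * countCoins m pC ≡ 2 ^ m
decisive-coin-halves m s pB pC s-flip swap compl =
  double #B≡#C total , double (sym #B≡#C) (trans (+-comm (countCoins m pC) _) total)
  where
  #B≡#C : countCoins m pB ≡ countCoins m pC
  #B≡#C = flip-swapped-counts s s-flip pB pC swap
  total : countCoins m pB + countCoins m pC ≡ 2 ^ m
  total = complementary-counts m pB pC compl
  double : ∀ {a b t} → a ≡ b → a + b ≡ t → 2 * a ≡ t
  double {a} refl a+a≡t = trans (cong (a +_) (+-identityʳ a)) a+a≡t

countᵇ : ∀ {m} → (Fin m → Bool) → ℕ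
countᵇ {zero} p = 0
countᵇ {suc m} p = fromBool (p zero) + countᵇ (λ i → p (suc i))

fromBool-mono : ∀ {a b} → (a ≡ true → b ≡ true) → fromBool a ≤ fromBool b
fromBool-mono {false} _ = z≤n
fromBool-mono {true} a⇒b rewrite a⇒b refl = ≤-refl

fromBool≤1 : ∀ a → fromBool a ≤ 1
fromBool≤1 true = ≤-refl
fromBool≤1 false = z≤n

countᵇ-mono : ∀ {m} (p q : Fin m → Bool) → (∀ i → p i ≡ true → q i ≡ true) → countᵇ p ≤ countᵇ q
countᵇ-mono {zero} p q p⇒q = z≤n
countᵇ-mono {suc m} p q p⇒q =
  +-mono-≤ (fromBool-mono (p⇒q zero)) (countᵇ-mono (λ i → p (suc i)) (λ i → q (suc i)) (λ i → p⇒q (suc i)))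

countᵇ-mono-< : ∀ {m} (p q : Fin m → Bool) → (∀ i → p i ≡ true → q i ≡ true) →
                ∀ j → p j ≡ false → q j ≡ true → countᵇ p < countᵇ q
countᵇ-mono-< {suc m} p q p⇒q zero pj qj rewrite pj | qj =
  s≤s (countᵇ-mono (λ i → p (suc i)) (λ i → q (suc i)) (λ i → p⇒q (suc i)))
countᵇ-mono-< {suc m} p q p⇒q (suc j) pj qj =
  subst (_≤ countᵇ q) (+-suc (fromBool (p zero)) _)
    (+-mono-≤ (fromBool-mono (p⇒q zero))
              (countᵇ-mono-< (λ i → p (suc i)) (λ i → q (suc i)) (λ i → p⇒q (suc i)) j pj qj))

countᵇ≤ : ∀ {m} (p : Fin m → Bool) → countᵇ p ≤ m
countᵇ≤ {zero} p = z≤n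
countᵇ≤ {suc m} p = +-mono-≤ (fromBool≤1 (p zero)) (countᵇ≤ (λ i → p (suc i)))

∈-allCoins : ∀ m (c : Vec Bool m) → c ∈ allCoins m
∈-allCoins zero [] = Any.here refl
∈-allCoins (suc m) (true ∷ c) = ∈-++⁺ˡ (∈-map⁺ (true ∷_) (∈-allCoins m c))
∈-allCoins (suc m) (false ∷ c) = ∈-++⁺ʳ (map (true ∷_) (allCoins m)) (∈-map⁺ (false ∷_) (∈-allCoins m c))

¬¬-∀-listed : ∀ {I : Set} {Q : I → Set} (xs : List I) → (∀ i → i ∈ xs) → (∀ i → ¬ ¬ Q i) → ¬ ¬ (∀ i → Q i)
¬¬-∀-listed {I} {Q} xs listed ¬¬Q = ¬¬-map (λ on-xs i → on-xs i (listed i)) (on xs)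
  where
  on : ∀ ys → ¬ ¬ (∀ i → i ∈ ys → Q i)
  on [] = λ ¬all → ¬all (λ _ ())
  on (y ∷ ys) ¬all = ¬¬Q y (λ qy → on ys (λ on-ys → ¬all λ { i (Any.here refl) → qy ; i (Any.there i∈) → on-ys i i∈ }))

module Maze (G : PlaneGraph) (T : Terminals G) where

  V : Set
  V = Fin (n G)

  D : Set
  D = Fin (d G)

  tgt : D → V
  tgt x = org G (α G x)

  α-injective : ∀ {x y} → α G x ≡ α G y → x ≡ y
  α-injective {x} {y} αx≡αy = trans (sym (α-invol G x)) (trans (cong (α G) αx≡αy) (α-invol G y))

  tgt-α : ∀ z → tgt (α G z) ≡ org G z
  tgt-α z = cong (org G) (α-invol G z)

  org-σσ : ∀ y → org G (σ G (σ G y)) ≡ org G y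
  org-σσ y = trans (σ-org G (σ G y)) (σ-org G y)

  iter-σ : ∀ k y → iter (σ G) k y ≡ y ⊎ iter (σ G) k y ≡ σ G y ⊎ iter (σ G) k y ≡ σ G (σ G y)
  iter-σ zero y = inj₁ refl
  iter-σ (suc k) y with iter-σ k y
  ... | inj₁ e = inj₂ (inj₁ (cong (σ G) e))
  ... | inj₂ (inj₁ e) = inj₂ (inj₂ (cong (σ G) e))
  ... | inj₂ (inj₂ e) with deg≤3 G y
  ...   | inj₁ σy≡y = inj₁ (trans (cong (σ G) e) (trans (cong (λ t → σ G (σ G t)) σy≡y)
                                                      (trans (cong (σ G) σy≡y) σy≡y)))
  ...   | inj₂ (inj₁ σσy≡y) = inj₂ (inj₁ (trans (cong (σ G) e) (cong (σ G) σσy≡y)))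
  ...   | inj₂ (inj₂ σσσy≡y) = inj₁ (trans (cong (σ G) e) σσσy≡y)

  darts-at : ∀ y z → org G z ≡ org G y → z ≡ y ⊎ z ≡ σ G y ⊎ z ≡ σ G (σ G y)
  darts-at y z same with σ-cyc G y z (sym same)
  ... | k , σᵏy≡z with iter-σ k y
  ...   | inj₁ e = inj₁ (trans (sym σᵏy≡z) e)
  ...   | inj₂ (inj₁ e) = inj₂ (inj₁ (trans (sym σᵏy≡z) e))
  ...   | inj₂ (inj₂ e) = inj₂ (inj₂ (trans (sym σᵏy≡z) e))

  data Reach∖ (P : V → Bool) : V → V → Set where
    stay : ∀ {u} → P u ≡ false → Reach∖ P u u
    move : ∀ {u w} (z : D) → P u ≡ false → org G z ≡ u → Reach∖ P (tgt z) w → Reach∖ P u w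

  module _ {P : V → Bool} where

    Reach∖-start : ∀ {u w} → Reach∖ P u w → P u ≡ false
    Reach∖-start (stay Pu) = Pu
    Reach∖-start (move _ Pu _ _) = Pu

    Reach∖-end : ∀ {u w} → Reach∖ P u w → P w ≡ false
    Reach∖-end (stay Pu) = Pu
    Reach∖-end (move _ _ _ r) = Reach∖-end r

    Reach∖-trans : ∀ {u v w} → Reach∖ P u v → Reach∖ P v w → Reach∖ P u w
    Reach∖-trans (stay _) r = r
    Reach∖-trans (move z Pu oz r) r′ = move z Pu oz (Reach∖-trans r r′)

    Reach∖-sym : ∀ {u w} → Reach∖ P u w → Reach∖ P w u
    Reach∖-sym (stay Pu) = stay Pu
    Reach∖-sym (move {u} z Pu oz r) =
      Reach∖-trans (Reach∖-sym r)
        (move (α G z) (Reach∖-start r) refl (subst (λ t → Reach∖ P t u) (sym (trans (tgt-α z) oz)) (stay Pu)))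

    Reach∖-join : ∀ {a b u w} → Reach∖ P a u → Reach∖ P b u → Reach∖ P b w → Reach∖ P a w
    Reach∖-join a⇝u b⇝u b⇝w = Reach∖-trans (Reach∖-trans a⇝u (Reach∖-sym b⇝u)) b⇝w

  Reach∖-mono : ∀ {P Q : V → Bool} {u w} → (∀ v → P v ≡ true → Q v ≡ true) → Reach∖ Q u w → Reach∖ P u w
  Reach∖-mono P⇒Q (stay Qu) = stay (contraposeᵇ (P⇒Q _) Qu)
  Reach∖-mono P⇒Q (move z Qu oz r) = move z (contraposeᵇ (P⇒Q _) Qu) oz (Reach∖-mono P⇒Q r)

  Reach∖-split : ∀ {P P′ : V → Bool} {b u w} → (∀ v → P′ v ≡ true → P v ≡ true ⊎ Reach∖ P b v) →
                 Reach∖ P u w → Reach∖ P′ u w ⊎ Reach∖ P b w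
  Reach∖-split {P} {P′} {b} P′⊆ = go
    where
    avoid-or-met : ∀ u → P u ≡ false → P′ u ≡ false ⊎ Reach∖ P b u
    avoid-or-met u Pu with P′ u in P′u
    ... | false = inj₁ refl
    ... | true with P′⊆ u P′u
    ...   | inj₁ Pu′ = ⊥-elim (≡true⇒≢false Pu′ Pu)
    ...   | inj₂ b⇝u = inj₂ b⇝u

    go : ∀ {u w} → Reach∖ P u w → Reach∖ P′ u w ⊎ Reach∖ P b w
    go {u} (stay Pu) with avoid-or-met u Pu
    ... | inj₁ P′u = inj₁ (stay P′u)
    ... | inj₂ b⇝u = inj₂ b⇝u
    go {u} (move z Pu oz r) with go r
    ... | inj₂ b⇝w = inj₂ b⇝w
    ... | inj₁ r′ with avoid-or-met u Pu
    ...   | inj₁ P′u = inj₁ (move z P′u oz r′)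
    ...   | inj₂ b⇝u = inj₂ (Reach∖-trans b⇝u (move z Pu oz r))

  Reach∖-last-exit : ∀ {vis u w} v → Reach∖ (_∈ᵇ vis) u w →
    w ≡ v ⊎ Reach∖ (_∈ᵇ (v ∷ vis)) u w ⊎ Σ[ z ∈ D ] (org G z ≡ v × Reach∖ (_∈ᵇ (v ∷ vis)) (tgt z) w)
  Reach∖-last-exit {vis} {u} v (stay u∉) with v ≟ u
  ... | yes v≡u = inj₁ (sym v≡u)
  ... | no v≢u = inj₂ (inj₁ (stay (∉ᵇ-∷ u v vis v≢u u∉)))
  Reach∖-last-exit {vis} {u} v (move z u∉ oz r) with Reach∖-last-exit {vis} v r
  ... | inj₁ w≡v = inj₁ w≡v
  ... | inj₂ (inj₂ exit) = inj₂ (inj₂ exit)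
  ... | inj₂ (inj₁ r′) with v ≟ u
  ...   | yes v≡u = inj₂ (inj₂ (z , trans oz (sym v≡u) , r′))
  ...   | no v≢u = inj₂ (inj₁ (move z (∉ᵇ-∷ u v vis v≢u u∉) oz r′))

  data Outcome : Set where
    exit   : Exit → Outcome
    halted : ℕ → List D → List V → (V → Maybe D) → D → Outcome
    stuck  : Outcome

  outcome-exit : Outcome → Maybe Exit
  outcome-exit (exit e) = just e
  outcome-exit _ = nothing

  used : List D → D → Bool
  used cr x = (x ∈ᵇ cr) ∨ (α G x ∈ᵇ cr)

  setEntry : (V → Maybe D) → V → D → V → Maybe D
  setEntry ent v y w = if ⌊ w ≟ v ⌋ then just y else ent w

  -- stop vis v y: whether to halt instead of entering the unvisited room v through dart y
  StopRule : Set
  StopRule = List V → V → D → Bool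

  neverStop : StopRule
  neverStop _ _ _ = false

  -- The walker of Defs, made able to halt: cross = crossing a dart, resume = back in a room
  -- whose entry dart is given, enter = first arrival in a room through the given dart.
  module Walker (stop : StopRule) (coin : V → Bool) where
    mutual
      cross : ℕ → List D → List V → (V → Maybe D) → D → Outcome
      cross zero cr vis ent x = stuck
      cross (suc k) cr vis ent x =
        if ⌊ tgt x ≟ B T ⌋ then exit exitB else
        if ⌊ tgt x ≟ C T ⌋ then exit exitC else
        if tgt x ∈ᵇ vis
          then (if not (used cr x) then cross k (x ∷ cr) vis ent (α G x)
                else resume k (x ∷ cr) vis ent (ent (tgt x)))
          else (if stop vis (tgt x) (α G x) then halted (suc k) cr vis ent x
                else enter k (x ∷ cr) (tgt x ∷ vis) (setEntry ent (tgt x) (α G x)) (α G x))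

      resume : ℕ → List D → List V → (V → Maybe D) → Maybe D → Outcome
      resume k cr vis ent nothing = stuck
      resume k cr vis ent (just e) =
        if not (used cr (σ G e)) then cross k cr vis ent (σ G e) else
        if not (used cr (σ G (σ G e))) then cross k cr vis ent (σ G (σ G e))
        else cross k cr vis ent e

      enter : ℕ → List D → List V → (V → Maybe D) → D → Outcome
      enter k cr vis ent y =
        if ⌊ σ G y ≟ y ⌋ then cross k cr vis ent y else
        if ⌊ σ G (σ G y) ≟ y ⌋ then cross k cr vis ent (σ G y) else
        if coin (org G y) then cross k cr vis ent (σ G y)
        else cross k cr vis ent (σ G (σ G y))

    module _ (k : ℕ) (cr : List D) (vis : List V) (ent : V → Maybe D) (x : D) where

      cross-B : tgt x ≡ B T → cross (suc k) cr vis ent x ≡ exit exitB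
      cross-B tgt≡B rewrite ⌊⌋-true (tgt x ≟ B T) tgt≡B = refl

      module _ (tgt≢B : tgt x ≢ B T) where

        cross-C : tgt x ≡ C T → cross (suc k) cr vis ent x ≡ exit exitC
        cross-C tgt≡C rewrite ⌊⌋-false (tgt x ≟ B T) tgt≢B | ⌊⌋-true (tgt x ≟ C T) tgt≡C = refl

        module _ (tgt≢C : tgt x ≢ C T) where

          cross-revisit-fresh : tgt x ∈ᵇ vis ≡ true → used cr x ≡ false →
                                cross (suc k) cr vis ent x ≡ cross k (x ∷ cr) vis ent (α G x)
          cross-revisit-fresh visited unused
            rewrite ⌊⌋-false (tgt x ≟ B T) tgt≢B | ⌊⌋-false (tgt x ≟ C T) tgt≢C | visited | unused = refl

          cross-revisit-used : tgt x ∈ᵇ vis ≡ true → used cr x ≡ true →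
                               cross (suc k) cr vis ent x ≡ resume k (x ∷ cr) vis ent (ent (tgt x))
          cross-revisit-used visited passed
            rewrite ⌊⌋-false (tgt x ≟ B T) tgt≢B | ⌊⌋-false (tgt x ≟ C T) tgt≢C | visited | passed = refl

          cross-halt : tgt x ∈ᵇ vis ≡ false → stop vis (tgt x) (α G x) ≡ true →
                       cross (suc k) cr vis ent x ≡ halted (suc k) cr vis ent x
          cross-halt unvisited stops
            rewrite ⌊⌋-false (tgt x ≟ B T) tgt≢B | ⌊⌋-false (tgt x ≟ C T) tgt≢C | unvisited | stops = refl

          cross-new : tgt x ∈ᵇ vis ≡ false → stop vis (tgt x) (α G x) ≡ false →
                      cross (suc k) cr vis ent x ≡
                      enter k (x ∷ cr) (tgt x ∷ vis) (setEntry ent (tgt x) (α G x)) (α G x)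
          cross-new unvisited goes-on
            rewrite ⌊⌋-false (tgt x ≟ B T) tgt≢B | ⌊⌋-false (tgt x ≟ C T) tgt≢C | unvisited | goes-on = refl

    module _ (k : ℕ) (cr : List D) (vis : List V) (ent : V → Maybe D) (e : D) where

      resume-σ : used cr (σ G e) ≡ false → resume k cr vis ent (just e) ≡ cross k cr vis ent (σ G e)
      resume-σ fresh rewrite fresh = refl

      resume-σσ : used cr (σ G e) ≡ true → used cr (σ G (σ G e)) ≡ false →
                  resume k cr vis ent (just e) ≡ cross k cr vis ent (σ G (σ G e))
      resume-σσ passed fresh rewrite passed | fresh = refl

      resume-back : used cr (σ G e) ≡ true → used cr (σ G (σ G e)) ≡ true →
                    resume k cr vis ent (just e) ≡ cross k cr vis ent e
      resume-back passed passed′ rewrite passed | passed′ = refl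

    module _ (k : ℕ) (cr : List D) (vis : List V) (ent : V → Maybe D) (y : D) where

      enter-deg1 : σ G y ≡ y → enter k cr vis ent y ≡ cross k cr vis ent y
      enter-deg1 deg1 rewrite ⌊⌋-true (σ G y ≟ y) deg1 = refl

      module _ (¬deg1 : σ G y ≢ y) where

        enter-deg2 : σ G (σ G y) ≡ y → enter k cr vis ent y ≡ cross k cr vis ent (σ G y)
        enter-deg2 deg2 rewrite ⌊⌋-false (σ G y ≟ y) ¬deg1 | ⌊⌋-true (σ G (σ G y) ≟ y) deg2 = refl

        module _ (¬deg2 : σ G (σ G y) ≢ y) where

          enter-heads : coin (org G y) ≡ true → enter k cr vis ent y ≡ cross k cr vis ent (σ G y)
          enter-heads heads
            rewrite ⌊⌋-false (σ G y ≟ y) ¬deg1 | ⌊⌋-false (σ G (σ G y) ≟ y) ¬deg2 | heads = refl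

          enter-tails : coin (org G y) ≡ false → enter k cr vis ent y ≡ cross k cr vis ent (σ G (σ G y))
          enter-tails tails
            rewrite ⌊⌋-false (σ G y ≟ y) ¬deg1 | ⌊⌋-false (σ G (σ G y) ≟ y) ¬deg2 | tails = refl

  run-is-cross : ∀ coin k cr vis ent x →
                 run G T coin k cr vis ent x ≡ outcome-exit (Walker.cross neverStop coin k cr vis ent x)
  run-is-cross coin zero cr vis ent x = refl
  run-is-cross coin (suc k) cr vis ent x with tgt x ≟ B T
  ... | yes _ = refl
  ... | no _ with tgt x ≟ C T
  ...   | yes _ = refl
  ...   | no _ with tgt x ∈ᵇ vis
  ...     | false with σ G (α G x) ≟ α G x
  ...       | yes _ = run-is-cross coin k _ _ _ _
  ...       | no _ with σ G (σ G (α G x)) ≟ α G x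
  ...         | yes _ = run-is-cross coin k _ _ _ _
  ...         | no _ with coin (tgt x)
  ...           | true = run-is-cross coin k _ _ _ _
  ...           | false = run-is-cross coin k _ _ _ _
  run-is-cross coin (suc k) cr vis ent x | no _ | no _ | true with used cr x
  ... | false = run-is-cross coin k (x ∷ cr) vis ent (α G x)
  ... | true with ent (tgt x)
  ...   | nothing = refl
  ...   | just e with used (x ∷ cr) (σ G e)
  ...     | false = run-is-cross coin k (x ∷ cr) vis ent (σ G e)
  ...     | true with used (x ∷ cr) (σ G (σ G e))
  ...       | false = run-is-cross coin k (x ∷ cr) vis ent (σ G (σ G e))
  ...       | true = run-is-cross coin k (x ∷ cr) vis ent e

  _⊆ᵇ_ : List V → List V → Set
  vis ⊆ᵇ vis′ = ∀ w → w ∈ᵇ vis ≡ true → w ∈ᵇ vis′ ≡ true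

  -- A walker that does not halt where W does not, and whose coins agree with those of W on
  -- the rooms W has visited when it halts, retraces W's walk up to that halt; Target says
  -- what it does there.
  module Simulation (stop : StopRule) (coin : V → Bool) (stop′ : StopRule) (coin′ : V → Bool)
    (stop′-false : ∀ vs v y → stop vs v y ≡ false → stop′ vs v y ≡ false)
    (Target : ℕ → List D → List V → (V → Maybe D) → D → Outcome)
    (at-halt : ∀ k cr vis ent x → tgt x ≢ B T → tgt x ≢ C T → tgt x ∈ᵇ vis ≡ false →
               stop vis (tgt x) (α G x) ≡ true →
               Walker.cross stop′ coin′ (suc k) cr vis ent x ≡ Target (suc k) cr vis ent x) where

    private
      module W = Walker stop coin
      module W′ = Walker stop′ coin′

    Agree : List V → Set
    Agree vis₂ = ∀ w → w ∈ᵇ vis₂ ≡ true → coin w ≡ coin′ w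

    mutual
      retrace-cross : ∀ k cr vis ent x {k₂ cr₂ vis₂ ent₂ x₂} →
        W.cross k cr vis ent x ≡ halted k₂ cr₂ vis₂ ent₂ x₂ → Agree vis₂ →
        W′.cross k cr vis ent x ≡ Target k₂ cr₂ vis₂ ent₂ x₂ × vis ⊆ᵇ vis₂
      retrace-cross zero cr vis ent x () agree
      retrace-cross (suc k) cr vis ent x h agree with toSum (tgt x ≟ B T)
      ... | inj₁ tgt≡B with () ← trans (sym (W.cross-B k cr vis ent x tgt≡B)) h
      ... | inj₂ tgt≢B with toSum (tgt x ≟ C T)
      ...   | inj₁ tgt≡C with () ← trans (sym (W.cross-C k cr vis ent x tgt≢B tgt≡C)) h
      ...   | inj₂ tgt≢C
                with true-or-false (tgt x ∈ᵇ vis) | true-or-false (used cr x) | true-or-false (stop vis (tgt x) (α G x))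
      ...     | inj₁ visited | inj₂ unused | _ =
        let (same , ⊆) = retrace-cross k (x ∷ cr) vis ent (α G x)
                           (trans (sym (W.cross-revisit-fresh k cr vis ent x tgt≢B tgt≢C visited unused)) h) agree
        in trans (W′.cross-revisit-fresh k cr vis ent x tgt≢B tgt≢C visited unused) same , ⊆
      ...     | inj₁ visited | inj₁ passed | _ =
        let (same , ⊆) = retrace-resume k (x ∷ cr) vis ent (ent (tgt x))
                           (trans (sym (W.cross-revisit-used k cr vis ent x tgt≢B tgt≢C visited passed)) h) agree
        in trans (W′.cross-revisit-used k cr vis ent x tgt≢B tgt≢C visited passed) same , ⊆
      ...     | inj₂ unvisited | _ | inj₁ stops
                with refl ← trans (sym (W.cross-halt k cr vis ent x tgt≢B tgt≢C unvisited stops)) h =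
        at-halt k cr vis ent x tgt≢B tgt≢C unvisited stops , λ _ w∈ → w∈
      ...     | inj₂ unvisited | _ | inj₂ goes-on =
        let (same , ⊆) = retrace-enter k (x ∷ cr) (tgt x ∷ vis) (setEntry ent (tgt x) (α G x)) (α G x)
                           (∈ᵇ-here (tgt x) vis)
                           (trans (sym (W.cross-new k cr vis ent x tgt≢B tgt≢C unvisited goes-on)) h) agree
        in trans (W′.cross-new k cr vis ent x tgt≢B tgt≢C unvisited (stop′-false _ _ _ goes-on)) same ,
           λ w w∈ → ⊆ w (∈ᵇ-there w (tgt x) vis w∈)

      retrace-resume : ∀ k cr vis ent me {k₂ cr₂ vis₂ ent₂ x₂} →
        W.resume k cr vis ent me ≡ halted k₂ cr₂ vis₂ ent₂ x₂ → Agree vis₂ →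
        W′.resume k cr vis ent me ≡ Target k₂ cr₂ vis₂ ent₂ x₂ × vis ⊆ᵇ vis₂
      retrace-resume k cr vis ent nothing () agree
      retrace-resume k cr vis ent (just e) h agree
        with true-or-false (used cr (σ G e)) | true-or-false (used cr (σ G (σ G e)))
      ... | inj₂ unused | _ =
        let (same , ⊆) = retrace-cross k cr vis ent (σ G e) (trans (sym (W.resume-σ k cr vis ent e unused)) h) agree
        in trans (W′.resume-σ k cr vis ent e unused) same , ⊆
      ... | inj₁ passed | inj₂ unused′ =
        let (same , ⊆) = retrace-cross k cr vis ent (σ G (σ G e))
                           (trans (sym (W.resume-σσ k cr vis ent e passed unused′)) h) agree
        in trans (W′.resume-σσ k cr vis ent e passed unused′) same , ⊆
      ... | inj₁ passed | inj₁ passed′ =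
        let (same , ⊆) = retrace-cross k cr vis ent e (trans (sym (W.resume-back k cr vis ent e passed passed′)) h) agree
        in trans (W′.resume-back k cr vis ent e passed passed′) same , ⊆

      retrace-enter : ∀ k cr vis ent y {k₂ cr₂ vis₂ ent₂ x₂} → org G y ∈ᵇ vis ≡ true →
        W.enter k cr vis ent y ≡ halted k₂ cr₂ vis₂ ent₂ x₂ → Agree vis₂ →
        W′.enter k cr vis ent y ≡ Target k₂ cr₂ vis₂ ent₂ x₂ × vis ⊆ᵇ vis₂
      retrace-enter k cr vis ent y y∈vis h agree with toSum (σ G y ≟ y)
      ... | inj₁ deg1 =
        let (same , ⊆) = retrace-cross k cr vis ent y (trans (sym (W.enter-deg1 k cr vis ent y deg1)) h) agree
        in trans (W′.enter-deg1 k cr vis ent y deg1) same , ⊆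
      ... | inj₂ ¬deg1 with toSum (σ G (σ G y) ≟ y)
      ...   | inj₁ deg2 =
        let (same , ⊆) = retrace-cross k cr vis ent (σ G y) (trans (sym (W.enter-deg2 k cr vis ent y ¬deg1 deg2)) h) agree
        in trans (W′.enter-deg2 k cr vis ent y ¬deg1 deg2) same , ⊆
      ...   | inj₂ ¬deg2 with true-or-false (coin (org G y))
      ...     | inj₁ toss =
        let (same , ⊆) = retrace-cross k cr vis ent (σ G y)
                           (trans (sym (W.enter-heads k cr vis ent y ¬deg1 ¬deg2 toss)) h) agree
            toss′ = trans (sym (agree (org G y) (⊆ (org G y) y∈vis))) toss
        in trans (W′.enter-heads k cr vis ent y ¬deg1 ¬deg2 toss′) same , ⊆
      ...     | inj₂ toss =
        let (same , ⊆) = retrace-cross k cr vis ent (σ G (σ G y))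
                           (trans (sym (W.enter-tails k cr vis ent y ¬deg1 ¬deg2 toss)) h) agree
            toss′ = trans (sym (agree (org G y) (⊆ (org G y) y∈vis))) toss
        in trans (W′.enter-tails k cr vis ent y ¬deg1 ¬deg2 toss′) same , ⊆

  setEntry-same : ∀ ent v y → setEntry ent v y v ≡ just y
  setEntry-same ent v y rewrite ⌊⌋-true (v ≟ v) refl = refl

  setEntry-other : ∀ ent v y w → w ≢ v → setEntry ent v y w ≡ ent w
  setEntry-other ent v y w w≢v rewrite ⌊⌋-false (w ≟ v) w≢v = refl

  visited≢unvisited : ∀ {vis : List V} {u w} → u ∈ᵇ vis ≡ true → w ∈ᵇ vis ≡ false → u ≢ w
  visited≢unvisited u∈ w∉ refl = ≡true⇒≢false u∈ w∉

  used⁺ : ∀ cr z → z ∈ᵇ cr ≡ true → used cr z ≡ true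
  used⁺ cr z = ∨-true⁺ˡ

  used⁺-α : ∀ cr z → α G z ∈ᵇ cr ≡ true → used cr z ≡ true
  used⁺-α cr z = ∨-true⁺ʳ {z ∈ᵇ cr}

  used⁻ : ∀ cr z → used cr z ≡ true → z ∈ᵇ cr ≡ true ⊎ α G z ∈ᵇ cr ≡ true
  used⁻ cr z = ∨-true⁻

  used-false⁻ : ∀ cr z → used cr z ≡ false → z ∈ᵇ cr ≡ false × α G z ∈ᵇ cr ≡ false
  used-false⁻ cr z unused = ∨-conicalˡ _ _ unused , ∨-conicalʳ _ _ unused

  used-α : ∀ cr z → used cr (α G z) ≡ used cr z
  used-α cr z = trans (cong (λ t → (α G z ∈ᵇ cr) ∨ (t ∈ᵇ cr)) (α-invol G z)) (∨-comm (α G z ∈ᵇ cr) (z ∈ᵇ cr))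

  used-here : ∀ cr z → used (z ∷ cr) z ≡ true
  used-here cr z = used⁺ (z ∷ cr) z (∈ᵇ-here z cr)

  used-here-α : ∀ cr z → used (z ∷ cr) (α G z) ≡ true
  used-here-α cr z = trans (used-α (z ∷ cr) z) (used-here cr z)

  used-++⁺ʳ : ∀ ys cr z → used cr z ≡ true → used (ys ++ cr) z ≡ true
  used-++⁺ʳ ys cr z passed with used⁻ cr z passed
  ... | inj₁ z∈ = used⁺ (ys ++ cr) z (∈ᵇ-++⁺ʳ z ys cr z∈)
  ... | inj₂ αz∈ = used⁺-α (ys ++ cr) z (∈ᵇ-++⁺ʳ (α G z) ys cr αz∈)

  uncrossed : List D → ℕ
  uncrossed cr = countᵇ (λ z → not (z ∈ᵇ cr))

  uncrossed-∷ : ∀ x cr → x ∈ᵇ cr ≡ false → uncrossed (x ∷ cr) < uncrossed cr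
  uncrossed-∷ x cr x∉ =
    countᵇ-mono-< _ _ (λ i i∉ → not-true⁺ (∨-conicalʳ _ _ (not-true⁻ i∉))) x
                  (cong not (∈ᵇ-here x cr)) (not-true⁺ x∉)

  fuel-pred : ∀ {k} x cr → uncrossed cr ≤ k → x ∈ᵇ cr ≡ false → uncrossed (x ∷ cr) < k
  fuel-pred x cr enough x∉ = <-≤-trans (uncrossed-∷ x cr x∉) enough

  no-fuel : ∀ {x cr} → x ∈ᵇ cr ≡ false → uncrossed cr ≤ 0 → ⊥
  no-fuel {x} {cr} x∉ enough with fuel-pred x cr enough x∉
  ... | ()

  fuel-step : ∀ {k} x cr → uncrossed cr ≤ k → x ∈ᵇ cr ≡ false → ∃[ k′ ] k ≡ suc k′ × uncrossed (x ∷ cr) ≤ k′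
  fuel-step {zero} x cr enough x∉ = ⊥-elim (no-fuel {x} {cr} x∉ enough)
  fuel-step {suc k′} x cr enough x∉ = k′ , refl , ≤-pred (fuel-pred x cr enough x∉)

  CrossedInside : List D → List V → Set
  CrossedInside cr vis = ∀ z → z ∈ᵇ cr ≡ true → org G z ∈ᵇ vis ≡ true × tgt z ∈ᵇ vis ≡ true

  ExitsUnvisited : List V → Set
  ExitsUnvisited vis = B T ∈ᵇ vis ≡ false × C T ∈ᵇ vis ≡ false

  visited≢B : ∀ {vis w} → ExitsUnvisited vis → w ∈ᵇ vis ≡ true → w ≢ B T
  visited≢B (B∉ , _) w∈ refl = ≡true⇒≢false w∈ B∉

  visited≢C : ∀ {vis w} → ExitsUnvisited vis → w ∈ᵇ vis ≡ true → w ≢ C T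
  visited≢C (_ , C∉) w∈ refl = ≡true⇒≢false w∈ C∉

  crossedInside-∷ : ∀ {cr vis x} → CrossedInside cr vis → org G x ∈ᵇ vis ≡ true →
                    CrossedInside (x ∷ cr) (tgt x ∷ vis)
  crossedInside-∷ {cr} {vis} {x} inside x-from z z∈ with ∈ᵇ-∷⁻ z x cr z∈
  ... | inj₁ refl = ∈ᵇ-there _ (tgt x) vis x-from , ∈ᵇ-here (tgt x) vis
  ... | inj₂ z∈cr = ∈ᵇ-there _ (tgt x) vis (proj₁ (inside z z∈cr)) , ∈ᵇ-there _ (tgt x) vis (proj₂ (inside z z∈cr))

  into-unvisited-uncrossed : ∀ {cr vis x} → CrossedInside cr vis → tgt x ∈ᵇ vis ≡ false → x ∈ᵇ cr ≡ false
  into-unvisited-uncrossed {x = x} inside x-to = contraposeᵇ (λ x∈ → proj₂ (inside x x∈)) x-to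

  new-room-doors-unused : ∀ {cr vis x z} → CrossedInside cr vis → org G x ∈ᵇ vis ≡ true → tgt x ∈ᵇ vis ≡ false →
                          org G z ≡ tgt x → z ≢ α G x → used (x ∷ cr) z ≡ false
  new-room-doors-unused {cr} {vis} {x} {z} inside x-from x-to oz z≢αx =
    ∨-false⁺ (∉ᵇ-∷ z x cr x≢z z∉) (∉ᵇ-∷ (α G z) x cr x≢αz αz∉)
    where
    x≢z : x ≢ z
    x≢z refl = visited≢unvisited {vis} x-from x-to oz
    z∉ : z ∈ᵇ cr ≡ false
    z∉ = contraposeᵇ (λ z∈ → proj₁ (inside z z∈)) (subst (λ u → u ∈ᵇ vis ≡ false) (sym oz) x-to)
    x≢αz : x ≢ α G z
    x≢αz x≡αz = z≢αx (trans (sym (α-invol G z)) (cong (α G) (sym x≡αz)))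
    αz∉ : α G z ∈ᵇ cr ≡ false
    αz∉ = contraposeᵇ (λ αz∈ → proj₂ (inside (α G z) αz∈))
                      (subst (λ u → u ∈ᵇ vis ≡ false) (sym (trans (tgt-α z) oz)) x-to)

  data Result (Halt : Set) (R : V → Set) (o : Outcome) (Ret : Set) : Set where
    exits-B : R (B T) → o ≡ exit exitB → Result Halt R o Ret
    exits-C : R (C T) → o ≡ exit exitC → Result Halt R o Ret
    halts   : R (B T) → Halt → Result Halt R o Ret
    returns : Ret → Result Halt R o Ret

  Result-map : ∀ {H R R′ o o′ P P′} → (∀ w → R w → R′ w) → o ≡ o′ → (P → P′) →
               Result H R o P → Result H R′ o′ P′
  Result-map f refl g (exits-B rB eq) = exits-B (f _ rB) eq
  Result-map f refl g (exits-C rC eq) = exits-C (f _ rC) eq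
  Result-map f refl g (halts rB h) = halts (f _ rB) h
  Result-map f refl g (returns r) = returns (g r)

  Continuation : Set
  Continuation = ℕ → List D → List V → (V → Maybe D) → Outcome

  -- The walker has explored exactly the region R beyond vis, is about to go on as next, and
  -- has meanwhile crossed only darts satisfying Near, never keep.
  record Return (cr : List D) (vis : List V) (ent : V → Maybe D) (R : V → Set) (Near : D → Set)
                (keep : D) (StepsOk : ℕ → Set) (next : Continuation) (o : Outcome) : Set where
    constructor mkReturn
    field
      steps : ℕ
      crossed : List D
      visited : List V
      entries : V → Maybe D
      newly-crossed : List D
      continues : o ≡ next steps crossed visited entries
      crossed≡ : crossed ≡ newly-crossed ++ cr
      newly-crossed-near : All Near newly-crossed
      newly-crossed-visited : All (λ w → org G w ∈ᵇ visited ≡ true × tgt w ∈ᵇ visited ≡ true) newly-crossed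
      visited⊆ : ∀ w → w ∈ᵇ visited ≡ true → w ∈ᵇ vis ≡ true ⊎ R w
      ⊆visited : ∀ w → w ∈ᵇ vis ≡ true ⊎ R w → w ∈ᵇ visited ≡ true
      entries-kept : ∀ w → w ∈ᵇ vis ≡ true → entries w ≡ ent w
      keep-uncrossed : keep ∈ᵇ crossed ≡ false
      steps-enough : uncrossed crossed ≤ steps
      steps-ok : StepsOk steps
      B∉region : ¬ R (B T)
      C∉region : ¬ R (C T)
  open Return public

  module _ {cr vis ent R Near keep StepsOk next o} (r : Return cr vis ent R Near keep StepsOk next o) where

    return-visited : ∀ w → w ∈ᵇ vis ≡ true → w ∈ᵇ visited r ≡ true
    return-visited w w∈ = ⊆visited r w (inj₁ w∈)

    return-used : ∀ z → used cr z ≡ true → used (crossed r) z ≡ true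
    return-used z passed = subst (λ t → used t z ≡ true) (sym (crossed≡ r)) (used-++⁺ʳ (newly-crossed r) cr z passed)

    return-crossedInside : CrossedInside cr vis → CrossedInside (crossed r) (visited r)
    return-crossedInside inside z z∈ with ∈ᵇ-++⁻ z (newly-crossed r) cr (subst (λ t → z ∈ᵇ t ≡ true) (crossed≡ r) z∈)
    ... | inj₁ z-new = ∈ᵇ-All z (newly-crossed r) (newly-crossed-visited r) z-new
    ... | inj₂ z-old = return-visited _ (proj₁ (inside z z-old)) , return-visited _ (proj₂ (inside z z-old))

    return-exitsUnvisited : ExitsUnvisited vis → ExitsUnvisited (visited r)
    return-exitsUnvisited (B∉ , C∉) = still-unvisited B∉ (B∉region r) , still-unvisited C∉ (C∉region r)
      where
      still-unvisited : ∀ {w} → w ∈ᵇ vis ≡ false → ¬ R w → w ∈ᵇ visited r ≡ false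
      still-unvisited {w} w∉ w∉R =
        ¬-not ([ (λ w∈vis → ≡true⇒≢false w∈vis w∉) , w∉R ]′ ∘ visited⊆ r w)

  -- The configuration just after crossing x into the unvisited room v = tgt x.
  module Entering {cr : List D} {vis : List V} {ent : V → Maybe D} {x : D} (inside : CrossedInside cr vis)
                  (x-from : org G x ∈ᵇ vis ≡ true) (x-to : tgt x ∈ᵇ vis ≡ false) where

    v : V
    v = tgt x

    y : D
    y = α G x

    cr′ : List D
    cr′ = x ∷ cr

    vis′ : List V
    vis′ = v ∷ vis

    ent′ : V → Maybe D
    ent′ = setEntry ent v y

    enough′ : ∀ {k} → uncrossed cr ≤ suc k → uncrossed cr′ ≤ k
    enough′ enough = ≤-pred (fuel-pred x cr enough (into-unvisited-uncrossed {cr} {vis} {x} inside x-to))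

    inside′ : CrossedInside cr′ vis′
    inside′ = crossedInside-∷ {cr} {vis} {x} inside x-from

    room-visited : v ∈ᵇ vis′ ≡ true
    room-visited = ∈ᵇ-here v vis

    door-from : ∀ {z} → org G z ≡ v → org G z ∈ᵇ vis′ ≡ true
    door-from oz = subst (λ u → u ∈ᵇ vis′ ≡ true) (sym oz) room-visited

    back-room-visited : tgt y ∈ᵇ vis ≡ true
    back-room-visited = subst (λ u → u ∈ᵇ vis ≡ true) (sym (tgt-α x)) x-from

    entry-recorded : ent′ v ≡ just y
    entry-recorded = setEntry-same ent v y

    entry-uncrossed : y ∈ᵇ cr′ ≡ false
    entry-uncrossed = ∉ᵇ-∷ y x cr (α-nofix G x ∘ sym) (contraposeᵇ (λ y∈ → proj₁ (inside y y∈)) x-to)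

    entry-used : used cr′ y ≡ true
    entry-used = used-here-α cr x

    other-doors-unused : ∀ z → org G z ≡ v → z ≢ y → used cr′ z ≡ false
    other-doors-unused z = new-room-doors-unused {cr} {vis} {x} {z} inside x-from x-to

    exits-still-unvisited : ExitsUnvisited vis → v ≢ B T → v ≢ C T → ExitsUnvisited vis′
    exits-still-unvisited (B∉ , C∉) v≢B v≢C = ∉ᵇ-∷ (B T) v vis v≢B B∉ , ∉ᵇ-∷ (C T) v vis v≢C C∉

  Unexplored : List D → List V → V → V → Set
  Unexplored cr vis v w = Σ[ z ∈ D ] (org G z ≡ v × used cr z ≡ false × Reach∖ (_∈ᵇ vis) (tgt z) w)

  Unexplored-antitone : ∀ {cr vis cr′ vis′ v w} → (∀ z → used cr z ≡ true → used cr′ z ≡ true) → vis ⊆ᵇ vis′ →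
                        Unexplored cr′ vis′ v w → Unexplored cr vis v w
  Unexplored-antitone more-used more-visited (z , oz , unused , r) =
    z , oz , contraposeᵇ (more-used z) unused , Reach∖-mono more-visited r

  Touches : (V → Set) → D → Set
  Touches R w = R (org G w) ⊎ R (tgt w)

  DoorOrTouches : D → (V → Set) → D → Set
  DoorOrTouches z R w = w ≡ z ⊎ w ≡ α G z ⊎ Touches R w

  AtOrTouches : V → (V → Set) → D → Set
  AtOrTouches v R w = org G w ≡ v ⊎ tgt w ≡ v ⊎ Touches R w

  -- The depth-first search explores exactly the rooms reachable without revisiting, as long as
  -- the stop rule halts only where B is still reachable.
  module Explore (stop : StopRule) (coin : V → Bool)
    (halt-reaches-B : ∀ vs v y → v ∈ᵇ vs ≡ false → org G y ≡ v → stop vs v y ≡ true →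
                      Reach∖ (_∈ᵇ vs) v (B T)) where

    open Walker stop coin

    HaltInfo : Set
    HaltInfo = Σ[ vs ∈ List V ] Σ[ v ∈ V ] Σ[ y ∈ D ] stop vs v y ≡ true

    crossing : D → Continuation
    crossing x k cr vis ent = cross k cr vis ent x

    resuming : D → Continuation
    resuming e k cr vis ent = resume k cr vis ent (just e)

    DoorReturn : ℕ → List D → List V → (V → Maybe D) → D → D → Outcome → Set
    DoorReturn k cr vis ent z e o =
      Return cr vis ent (Reach∖ (_∈ᵇ vis) (tgt z)) (DoorOrTouches z (Reach∖ (_∈ᵇ vis) (tgt z))) e (_< k) (resuming e) o

    RoomReturn : ℕ → List D → List V → (V → Maybe D) → V → D → Outcome → Set
    RoomReturn k cr vis ent v y o =
      Return cr vis ent (Unexplored cr vis v) (AtOrTouches v (Unexplored cr vis v)) y (_≤ k) (crossing y) o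

    CrossReturn : ℕ → List D → List V → (V → Maybe D) → D → Outcome → Set
    CrossReturn k cr vis ent x o =
      Σ (Return cr vis ent (Reach∖ (_∈ᵇ vis) (tgt x)) (Touches (Reach∖ (_∈ᵇ vis) (tgt x))) (α G x) (_< k)
                (crossing (α G x)) o)
        (λ r → x ∈ᵇ crossed r ≡ true)

    module _ {k cr vis ent z e o} (r : DoorReturn k cr vis ent z e o) where

      door-far-side-visited : tgt z ∈ᵇ visited r ≡ true
      door-far-side-visited with true-or-false (tgt z ∈ᵇ vis)
      ... | inj₁ visited-before = return-visited r _ visited-before
      ... | inj₂ unvisited = ⊆visited r _ (inj₂ (stay unvisited))

      unvisited-door-uncrossed : ∀ {v z′ t} → org G z ≡ v → v ∈ᵇ vis ≡ true → org G z′ ≡ v →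
        tgt z′ ∈ᵇ visited r ≡ false → (t ≡ z′ ⊎ t ≡ α G z′) → ¬ DoorOrTouches z (Reach∖ (_∈ᵇ vis) (tgt z)) t
      unvisited-door-uncrossed oz v∈ oz′ far∉ (inj₁ refl) (inj₁ refl) = ≡true⇒≢false door-far-side-visited far∉
      unvisited-door-uncrossed oz v∈ oz′ far∉ (inj₁ refl) (inj₂ (inj₁ refl)) = no-loop G z (trans oz′ (sym oz))
      unvisited-door-uncrossed oz v∈ oz′ far∉ (inj₁ refl) (inj₂ (inj₂ (inj₁ ra))) =
        ≡true⇒≢false v∈ (subst (λ u → u ∈ᵇ vis ≡ false) oz′ (Reach∖-end ra))
      unvisited-door-uncrossed oz v∈ oz′ far∉ (inj₁ refl) (inj₂ (inj₂ (inj₂ ra))) =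
        ≡true⇒≢false (⊆visited r _ (inj₂ ra)) far∉
      unvisited-door-uncrossed {z′ = z′} oz v∈ oz′ far∉ (inj₂ refl) (inj₁ αz′≡z) =
        no-loop G z′ (trans (cong (org G) αz′≡z) (trans oz (sym oz′)))
      unvisited-door-uncrossed oz v∈ oz′ far∉ (inj₂ refl) (inj₂ (inj₁ αz′≡αz)) =
        ≡true⇒≢false (subst (λ t → tgt t ∈ᵇ visited r ≡ true) (sym (α-injective αz′≡αz)) door-far-side-visited) far∉
      unvisited-door-uncrossed oz v∈ oz′ far∉ (inj₂ refl) (inj₂ (inj₂ (inj₁ ra))) =
        ≡true⇒≢false (⊆visited r _ (inj₂ ra)) far∉
      unvisited-door-uncrossed {z′ = z′} oz v∈ oz′ far∉ (inj₂ refl) (inj₂ (inj₂ (inj₂ ra))) =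
        ≡true⇒≢false v∈ (subst (λ u → u ∈ᵇ vis ≡ false) (trans (tgt-α z′) oz′) (Reach∖-end ra))

      Unexplored-split : ∀ {v} → org G z ≡ v → v ∈ᵇ vis ≡ true → ∀ w → Unexplored cr vis v w →
                         Reach∖ (_∈ᵇ vis) (tgt z) w ⊎ Unexplored (crossed r) (visited r) v w
      Unexplored-split {v} oz v∈ w (z′ , oz′ , unused , ra)
        with Reach∖-split {P = _∈ᵇ vis} {P′ = _∈ᵇ visited r} {b = tgt z} (visited⊆ r) ra
      ... | inj₂ beyond-z = inj₁ beyond-z
      ... | inj₁ ra′ = inj₂ (z′ , oz′ , still-unused , ra′)
        where
        old : ∀ t → (t ≡ z′ ⊎ t ≡ α G z′) → t ∈ᵇ crossed r ≡ true → t ∈ᵇ cr ≡ true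
        old t t-door t∈ with ∈ᵇ-++⁻ t (newly-crossed r) cr (subst (λ l → t ∈ᵇ l ≡ true) (crossed≡ r) t∈)
        ... | inj₁ t-new = ⊥-elim (unvisited-door-uncrossed oz v∈ oz′ (Reach∖-start ra′) t-door
                                     (∈ᵇ-All t (newly-crossed r) (newly-crossed-near r) t-new))
        ... | inj₂ t-old = t-old
        still-unused : used (crossed r) z′ ≡ false
        still-unused = ¬-not λ passed → ≡true⇒≢false (still-old passed) unused
          where
          still-old : used (crossed r) z′ ≡ true → used cr z′ ≡ true
          still-old passed with used⁻ (crossed r) z′ passed
          ... | inj₁ z′∈ = used⁺ cr z′ (old z′ (inj₁ refl) z′∈)
          ... | inj₂ αz′∈ = used⁺-α cr z′ (old (α G z′) (inj₂ refl) αz′∈)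

    door-then-rest : ∀ {k cr vis ent v y z o} → org G z ≡ v → used cr z ≡ false → v ∈ᵇ vis ≡ true →
      Result HaltInfo (Reach∖ (_∈ᵇ vis) (tgt z)) o (DoorReturn k cr vis ent z y o) →
      ((r : DoorReturn k cr vis ent z y o) →
        let o′ = resume (steps r) (crossed r) (visited r) (entries r) (just y) in
        Result HaltInfo (Unexplored (crossed r) (visited r) v) o′
               (RoomReturn (steps r) (crossed r) (visited r) (entries r) v y o′)) →
      Result HaltInfo (Unexplored cr vis v) o (RoomReturn k cr vis ent v y o)
    door-then-rest oz unused v∈ (exits-B rB eq) rest = exits-B (_ , oz , unused , rB) eq
    door-then-rest oz unused v∈ (exits-C rC eq) rest = exits-C (_ , oz , unused , rC) eq
    door-then-rest oz unused v∈ (halts rB h) rest = halts (_ , oz , unused , rB) h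
    door-then-rest {k} {cr} {vis} {ent} {v} {y} {z} {o} oz unused v∈ (returns r) rest = combine (rest r)
      where
      lift : ∀ {w} → Unexplored (crossed r) (visited r) v w → Unexplored cr vis v w
      lift = Unexplored-antitone {cr} {vis} {crossed r} {visited r} {v} (return-used r) (return-visited r)
      Rz : V → Set
      Rz = Reach∖ (_∈ᵇ vis) (tgt z)
      through-z : ∀ {w} → Rz w → Unexplored cr vis v w
      through-z rz = z , oz , unused , rz
      near-rest : ∀ w → AtOrTouches v (Unexplored (crossed r) (visited r) v) w → AtOrTouches v (Unexplored cr vis v) w
      near-rest w (inj₁ e) = inj₁ e
      near-rest w (inj₂ (inj₁ e)) = inj₂ (inj₁ e)
      near-rest w (inj₂ (inj₂ (inj₁ rl))) = inj₂ (inj₂ (inj₁ (lift rl)))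
      near-rest w (inj₂ (inj₂ (inj₂ rl))) = inj₂ (inj₂ (inj₂ (lift rl)))
      near-door : ∀ w → DoorOrTouches z Rz w → AtOrTouches v (Unexplored cr vis v) w
      near-door w (inj₁ refl) = inj₁ oz
      near-door w (inj₂ (inj₁ refl)) = inj₂ (inj₁ (trans (tgt-α z) oz))
      near-door w (inj₂ (inj₂ (inj₁ rz))) = inj₂ (inj₂ (inj₁ (through-z rz)))
      near-door w (inj₂ (inj₂ (inj₂ rz))) = inj₂ (inj₂ (inj₂ (through-z rz)))

      o′ : Outcome
      o′ = resume (steps r) (crossed r) (visited r) (entries r) (just y)

      combine : Result HaltInfo (Unexplored (crossed r) (visited r) v) o′
                       (RoomReturn (steps r) (crossed r) (visited r) (entries r) v y o′) →
                Result HaltInfo (Unexplored cr vis v) o (RoomReturn k cr vis ent v y o)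
      combine (exits-B rB eq) = exits-B (lift rB) (trans (continues r) eq)
      combine (exits-C rC eq) = exits-C (lift rC) (trans (continues r) eq)
      combine (halts rB h) = halts (lift rB) h
      combine (returns r′) = returns (mkReturn (steps r′) (crossed r′) (visited r′) (entries r′)
              (newly-crossed r′ ++ newly-crossed r)
              (trans (continues r) (continues r′))
              (trans (crossed≡ r′) (trans (cong (newly-crossed r′ ++_) (crossed≡ r))
                                          (sym (++-assoc (newly-crossed r′) (newly-crossed r) cr))))
              (++⁺ (All.map (near-rest _) (newly-crossed-near r′)) (All.map (near-door _) (newly-crossed-near r)))
              (++⁺ (newly-crossed-visited r′)
                   (All.map (λ {w} (o∈ , t∈) → return-visited r′ _ o∈ , return-visited r′ _ t∈) (newly-crossed-visited r)))
              visited⊆′ ⊆visited′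
              (λ w w∈ → trans (entries-kept r′ w (return-visited r w w∈)) (entries-kept r w w∈))
              (keep-uncrossed r′) (steps-enough r′) (≤-trans (steps-ok r′) (<⇒≤ (steps-ok r)))
              B∉ C∉)
        where
        visited⊆′ : ∀ w → w ∈ᵇ visited r′ ≡ true → w ∈ᵇ vis ≡ true ⊎ Unexplored cr vis v w
        visited⊆′ w w∈ with visited⊆ r′ w w∈
        ... | inj₂ rl = inj₂ (lift rl)
        ... | inj₁ w∈r with visited⊆ r w w∈r
        ...   | inj₁ w∈vis = inj₁ w∈vis
        ...   | inj₂ rz = inj₂ (through-z rz)
        ⊆visited′ : ∀ w → w ∈ᵇ vis ≡ true ⊎ Unexplored cr vis v w → w ∈ᵇ visited r′ ≡ true
        ⊆visited′ w (inj₁ w∈) = return-visited r′ w (return-visited r w w∈)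
        ⊆visited′ w (inj₂ rl) with Unexplored-split r oz v∈ w rl
        ... | inj₁ rz = return-visited r′ w (⊆visited r w (inj₂ rz))
        ... | inj₂ rl′ = ⊆visited r′ w (inj₂ rl′)
        B∉ : ¬ Unexplored cr vis v (B T)
        B∉ rl with Unexplored-split r oz v∈ (B T) rl
        ... | inj₁ rz = B∉region r rz
        ... | inj₂ rl′ = B∉region r′ rl′
        C∉ : ¬ Unexplored cr vis v (C T)
        C∉ rl with Unexplored-split r oz v∈ (C T) rl
        ... | inj₁ rz = C∉region r rz
        ... | inj₂ rl′ = C∉region r′ rl′

    bounce : ∀ k cr vis ent z e → uncrossed cr ≤ k → ExitsUnvisited vis →
      org G z ∈ᵇ vis ≡ true → used cr z ≡ false → ent (org G z) ≡ just e →
      e ∈ᵇ cr ≡ false → e ≢ z → e ≢ α G z → tgt z ∈ᵇ vis ≡ true →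
      Σ (DoorReturn k cr vis ent z e (cross k cr vis ent z)) (λ r → used (crossed r) z ≡ true)
    bounce k cr vis ent z e enough exits∉ z-from unused entry e∉ e≢z e≢αz z-to
      with used-false⁻ cr z unused
    ... | z∉ , αz∉ with fuel-step z cr enough z∉
    ...   | k₁ , refl , enough₁ with fuel-step (α G z) (z ∷ cr) enough₁ (∉ᵇ-∷ (α G z) z cr (α-nofix G z ∘ sym) αz∉)
    ...     | k₂ , refl , enough₂ =
      mkReturn k₂ (α G z ∷ z ∷ cr) vis ent (α G z ∷ z ∷ []) there-and-back refl
        (inj₂ (inj₁ refl) ∷ inj₁ refl ∷ []) ((z-to , back-to) ∷ (z-from , z-to) ∷ [])
        (λ w w∈ → inj₁ w∈) (λ w → [ (λ w∈ → w∈) , ⊥-elim ∘ nothing-beyond ]′) (λ w w∈ → refl)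
        (∉ᵇ-∷ e (α G z) (z ∷ cr) (e≢αz ∘ sym) (∉ᵇ-∷ e z cr (e≢z ∘ sym) e∉))
        enough₂ (s≤s (n≤1+n k₂)) nothing-beyond nothing-beyond
      , used⁺-α (α G z ∷ z ∷ cr) z (∈ᵇ-here (α G z) (z ∷ cr))
      where
      back-to : tgt (α G z) ∈ᵇ vis ≡ true
      back-to = subst (λ u → u ∈ᵇ vis ≡ true) (sym (tgt-α z)) z-from
      there-and-back : cross (suc (suc k₂)) cr vis ent z ≡ resume k₂ (α G z ∷ z ∷ cr) vis ent (just e)
      there-and-back = begin
        cross (suc (suc k₂)) cr vis ent z
          ≡⟨ cross-revisit-fresh (suc k₂) cr vis ent z (visited≢B {vis} exits∉ z-to) (visited≢C {vis} exits∉ z-to) z-to unused ⟩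
        cross (suc k₂) (z ∷ cr) vis ent (α G z)
          ≡⟨ cross-revisit-used k₂ (z ∷ cr) vis ent (α G z) (visited≢B {vis} exits∉ back-to) (visited≢C {vis} exits∉ back-to)
                                back-to (used-here-α cr z) ⟩
        resume k₂ (α G z ∷ z ∷ cr) vis ent (ent (tgt (α G z)))
          ≡⟨ cong (resume k₂ (α G z ∷ z ∷ cr) vis ent) (trans (cong ent (tgt-α z)) entry) ⟩
        resume k₂ (α G z ∷ z ∷ cr) vis ent (just e) ∎
        where open ≡-Reasoning
      nothing-beyond : ∀ {w} → ¬ Reach∖ (_∈ᵇ vis) (tgt z) w
      nothing-beyond r = ≡true⇒≢false z-to (Reach∖-start r)

    cross-back : ∀ k cr vis ent z → uncrossed cr ≤ k → α G z ∈ᵇ cr ≡ false → ExitsUnvisited vis →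
      org G z ∈ᵇ vis ≡ true → z ∈ᵇ cr ≡ true →
      Σ[ k′ ∈ ℕ ] (k ≡ suc k′ × cross k cr vis ent (α G z) ≡ resume k′ (α G z ∷ cr) vis ent (ent (org G z))
                   × uncrossed (α G z ∷ cr) ≤ k′)
    cross-back k cr vis ent z enough αz∉ exits∉ z-from z∈ with fuel-step (α G z) cr enough αz∉
    ... | k′ , refl , enough′ =
      k′ , refl ,
      trans (cross-revisit-used k′ cr vis ent (α G z) (visited≢B {vis} exits∉ back-to) (visited≢C {vis} exits∉ back-to) back-to
                                (trans (used-α cr z) (used⁺ cr z z∈)))
            (cong (λ u → resume k′ (α G z ∷ cr) vis ent (ent u)) (tgt-α z)) ,
      enough′
      where
      back-to : tgt (α G z) ∈ᵇ vis ≡ true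
      back-to = subst (λ u → u ∈ᵇ vis ≡ true) (sym (tgt-α z)) z-from

    -- Beyond the door x into the unvisited room v = tgt x lie v itself and what lies beyond
    -- the other doors of v.
    cross-result : ∀ {k cr vis ent x o} → CrossedInside cr vis → org G x ∈ᵇ vis ≡ true → tgt x ∈ᵇ vis ≡ false →
      tgt x ≢ B T → tgt x ≢ C T →
      Result HaltInfo (Unexplored (x ∷ cr) (tgt x ∷ vis) (tgt x)) o
        (RoomReturn k (x ∷ cr) (tgt x ∷ vis) (setEntry ent (tgt x) (α G x)) (tgt x) (α G x) o) →
      Result HaltInfo (Reach∖ (_∈ᵇ vis) (tgt x)) o (CrossReturn (suc k) cr vis ent x o)
    cross-result {k} {cr} {vis} {ent} {x} {o} inside x-from x-to tgt≢B tgt≢C =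
      Result-map beyond-door refl from-room
      where
      open Entering {cr} {vis} {ent} {x} inside x-from x-to
      Rv : V → Set
      Rv = Reach∖ (_∈ᵇ vis) v
      beyond-door : ∀ w → Unexplored (x ∷ cr) (v ∷ vis) v w → Rv w
      beyond-door w (z , oz , _ , r) = move z x-to oz (Reach∖-mono (λ u u∈ → ∈ᵇ-there u v vis u∈) r)
      room-or-beyond : ∀ w → Rv w → w ≡ v ⊎ Unexplored (x ∷ cr) (v ∷ vis) v w
      room-or-beyond w r with Reach∖-last-exit {vis} v r
      ... | inj₁ w≡v = inj₁ w≡v
      ... | inj₂ (inj₁ r′) = ⊥-elim (≡true⇒≢false room-visited (Reach∖-start r′))
      ... | inj₂ (inj₂ (z , oz , r′)) = inj₂ (z , oz , other-doors-unused z oz z≢αx , r′)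
        where
        z≢αx : z ≢ α G x
        z≢αx refl = ≡true⇒≢false (∈ᵇ-there _ v vis back-room-visited) (Reach∖-start r′)
      near : ∀ w → AtOrTouches v (Unexplored (x ∷ cr) (v ∷ vis) v) w → Touches Rv w
      near w (inj₁ e) = inj₁ (subst Rv (sym e) (stay x-to))
      near w (inj₂ (inj₁ e)) = inj₂ (subst Rv (sym e) (stay x-to))
      near w (inj₂ (inj₂ (inj₁ rl))) = inj₁ (beyond-door _ rl)
      near w (inj₂ (inj₂ (inj₂ rl))) = inj₂ (beyond-door _ rl)
      from-room : RoomReturn k (x ∷ cr) (v ∷ vis) (setEntry ent v (α G x)) v (α G x) o → CrossReturn (suc k) cr vis ent x o
      from-room r =
        mkReturn (steps r) (crossed r) (visited r) (entries r) (newly-crossed r ++ x ∷ []) (continues r)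
          (trans (crossed≡ r) (sym (++-assoc (newly-crossed r) (x ∷ []) cr)))
          (++⁺ (All.map (near _) (newly-crossed-near r)) (inj₂ (stay x-to) ∷ []))
          (++⁺ (newly-crossed-visited r)
               ((return-visited r _ (∈ᵇ-there _ v vis x-from) , return-visited r _ room-visited) ∷ []))
          visited⊆′ ⊆visited′ entries-kept′ (keep-uncrossed r) (steps-enough r) (s≤s (steps-ok r)) B∉ C∉
        , subst (λ l → x ∈ᵇ l ≡ true) (sym (crossed≡ r)) (∈ᵇ-++⁺ʳ x (newly-crossed r) (x ∷ cr) (∈ᵇ-here x cr))
        where
        visited⊆′ : ∀ w → w ∈ᵇ visited r ≡ true → w ∈ᵇ vis ≡ true ⊎ Rv w
        visited⊆′ w w∈ with visited⊆ r w w∈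
        ... | inj₂ rl = inj₂ (beyond-door w rl)
        ... | inj₁ w∈′ with ∈ᵇ-∷⁻ w v vis w∈′
        ...   | inj₁ v≡w = inj₂ (subst Rv v≡w (stay x-to))
        ...   | inj₂ w∈vis = inj₁ w∈vis
        ⊆visited′ : ∀ w → w ∈ᵇ vis ≡ true ⊎ Rv w → w ∈ᵇ visited r ≡ true
        ⊆visited′ w (inj₁ w∈) = return-visited r w (∈ᵇ-there w v vis w∈)
        ⊆visited′ w (inj₂ rw) with room-or-beyond w rw
        ... | inj₁ refl = return-visited r _ room-visited
        ... | inj₂ rl = ⊆visited r w (inj₂ rl)
        entries-kept′ : ∀ w → w ∈ᵇ vis ≡ true → entries r w ≡ ent w
        entries-kept′ w w∈ = trans (entries-kept r w (∈ᵇ-there w v vis w∈))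
                                   (setEntry-other ent v (α G x) w (visited≢unvisited {vis} w∈ x-to))
        B∉ : ¬ Rv (B T)
        B∉ rB with room-or-beyond (B T) rB
        ... | inj₁ B≡v = tgt≢B (sym B≡v)
        ... | inj₂ rl = B∉region r rl
        C∉ : ¬ Rv (C T)
        C∉ rC with room-or-beyond (C T) rC
        ... | inj₁ C≡v = tgt≢C (sym C≡v)
        ... | inj₂ rl = C∉region r rl

    -- The bound m on the step counter k decreases along every recursive call, whereas k
    -- itself does not visibly decrease after an exploration has returned.
    explore-cross : ∀ m k cr vis ent x → k ≤ m → uncrossed cr ≤ k → CrossedInside cr vis → ExitsUnvisited vis →
      org G x ∈ᵇ vis ≡ true → tgt x ∈ᵇ vis ≡ false →
      Result HaltInfo (Reach∖ (_∈ᵇ vis) (tgt x)) (cross k cr vis ent x) (CrossReturn k cr vis ent x (cross k cr vis ent x))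
    explore-enter : ∀ m k cr vis ent x → k ≤ m → uncrossed (x ∷ cr) ≤ k → CrossedInside cr vis → ExitsUnvisited vis →
      org G x ∈ᵇ vis ≡ true → tgt x ∈ᵇ vis ≡ false → tgt x ≢ B T → tgt x ≢ C T →
      let cr′ = x ∷ cr ; vis′ = tgt x ∷ vis ; ent′ = setEntry ent (tgt x) (α G x) in
      Result HaltInfo (Unexplored cr′ vis′ (tgt x)) (enter k cr′ vis′ ent′ (α G x))
        (RoomReturn k cr′ vis′ ent′ (tgt x) (α G x) (enter k cr′ vis′ ent′ (α G x)))
    explore-door : ∀ m k cr vis ent z e → k ≤ m → uncrossed cr ≤ k → CrossedInside cr vis → ExitsUnvisited vis →
      org G z ∈ᵇ vis ≡ true → used cr z ≡ false → ent (org G z) ≡ just e →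
      e ∈ᵇ cr ≡ false → e ≢ z → e ≢ α G z →
      ¬ Reach∖ (_∈ᵇ vis) (tgt z) (org G e) → ¬ Reach∖ (_∈ᵇ vis) (tgt z) (tgt e) →
      Result HaltInfo (Reach∖ (_∈ᵇ vis) (tgt z)) (cross k cr vis ent z)
        (Σ (DoorReturn k cr vis ent z e (cross k cr vis ent z)) (λ r → used (crossed r) z ≡ true))
    explore-resume : ∀ m k cr vis ent v y → k ≤ m → uncrossed cr ≤ k → CrossedInside cr vis → ExitsUnvisited vis →
      v ∈ᵇ vis ≡ true → org G y ≡ v → ent v ≡ just y → y ∈ᵇ cr ≡ false → used cr y ≡ true →
      Result HaltInfo (Unexplored cr vis v) (resume k cr vis ent (just y))
        (RoomReturn k cr vis ent v y (resume k cr vis ent (just y)))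
    explore-door-then-resume : ∀ m k cr vis ent v y z → k ≤ m → uncrossed cr ≤ k → CrossedInside cr vis →
      ExitsUnvisited vis → v ∈ᵇ vis ≡ true → org G y ≡ v → ent v ≡ just y → y ∈ᵇ cr ≡ false → used cr y ≡ true →
      org G z ≡ v → used cr z ≡ false →
      Result HaltInfo (Unexplored cr vis v) (cross k cr vis ent z) (RoomReturn k cr vis ent v y (cross k cr vis ent z))

    explore-cross zero k cr vis ent x k≤m enough inside exits∉ x-from x-to =
      ⊥-elim (no-fuel {x} {cr} (into-unvisited-uncrossed {cr} {vis} {x} inside x-to) (≤-trans enough k≤m))
    explore-cross (suc m) zero cr vis ent x k≤m enough inside exits∉ x-from x-to =
      ⊥-elim (no-fuel {x} {cr} (into-unvisited-uncrossed {cr} {vis} {x} inside x-to) enough)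
    explore-cross (suc m) (suc k) cr vis ent x k≤m enough inside exits∉ x-from x-to with toSum (tgt x ≟ B T)
    ... | inj₁ tgt≡B = exits-B (subst (Reach∖ (_∈ᵇ vis) (tgt x)) tgt≡B (stay x-to)) (cross-B k cr vis ent x tgt≡B)
    ... | inj₂ tgt≢B with toSum (tgt x ≟ C T)
    ...   | inj₁ tgt≡C = exits-C (subst (Reach∖ (_∈ᵇ vis) (tgt x)) tgt≡C (stay x-to)) (cross-C k cr vis ent x tgt≢B tgt≡C)
    ...   | inj₂ tgt≢C with true-or-false (stop vis (tgt x) (α G x))
    ...     | inj₁ stops = halts (halt-reaches-B vis (tgt x) (α G x) x-to refl stops) (vis , tgt x , α G x , stops)
    ...     | inj₂ goes-on =
      cross-result {k} {cr} {vis} {ent} {x} inside x-from x-to tgt≢B tgt≢C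
        (subst (λ o → Result HaltInfo (Unexplored (x ∷ cr) (tgt x ∷ vis) (tgt x)) o
                        (RoomReturn k (x ∷ cr) (tgt x ∷ vis) (setEntry ent (tgt x) (α G x)) (tgt x) (α G x) o))
          (sym (cross-new k cr vis ent x tgt≢B tgt≢C x-to goes-on))
          (explore-enter m k cr vis ent x (≤-pred k≤m)
            (≤-pred (fuel-pred x cr enough (into-unvisited-uncrossed {cr} {vis} {x} inside x-to)))
            inside exits∉ x-from x-to tgt≢B tgt≢C))

    explore-enter m k cr vis ent x k≤m enough inside exits∉ x-from x-to tgt≢B tgt≢C =
      by-degree (toSum (σ G y ≟ y)) (toSum (σ G (σ G y) ≟ y)) (true-or-false (coin v))
      where
      open Entering {cr} {vis} {ent} {x} inside x-from x-to
      Goal : Outcome → Set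
      Goal o = Result HaltInfo (Unexplored cr′ vis′ v) o (RoomReturn k cr′ vis′ ent′ v y o)
      exits∉′ : ExitsUnvisited vis′
      exits∉′ = exits-still-unvisited exits∉ tgt≢B tgt≢C
      rest-of-room : Goal (resume k cr′ vis′ ent′ (just y))
      rest-of-room = explore-resume m k cr′ vis′ ent′ v y k≤m enough inside′ exits∉′ room-visited refl
                       entry-recorded entry-uncrossed entry-used
      by-degree : σ G y ≡ y ⊎ σ G y ≢ y → σ G (σ G y) ≡ y ⊎ σ G (σ G y) ≢ y → coin v ≡ true ⊎ coin v ≡ false →
                  Goal (enter k cr′ vis′ ent′ y)
      by-degree (inj₁ deg1) _ _ =
        subst Goal (trans (resume-back k cr′ vis′ ent′ y σy-used σσy-used) (sym (enter-deg1 k cr′ vis′ ent′ y deg1)))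
          rest-of-room
        where
        σy-used : used cr′ (σ G y) ≡ true
        σy-used = subst (λ t → used cr′ t ≡ true) (sym deg1) entry-used
        σσy-used : used cr′ (σ G (σ G y)) ≡ true
        σσy-used = subst (λ t → used cr′ t ≡ true) (sym (trans (cong (σ G) deg1) deg1)) entry-used
      by-degree (inj₂ ¬deg1) (inj₁ deg2) _ =
        subst Goal (trans (resume-σ k cr′ vis′ ent′ y (other-doors-unused (σ G y) (σ-org G y) ¬deg1))
                          (sym (enter-deg2 k cr′ vis′ ent′ y ¬deg1 deg2)))
          rest-of-room
      by-degree (inj₂ ¬deg1) (inj₂ ¬deg2) (inj₁ heads) =
        subst Goal (trans (resume-σ k cr′ vis′ ent′ y (other-doors-unused (σ G y) (σ-org G y) ¬deg1))
                          (sym (enter-heads k cr′ vis′ ent′ y ¬deg1 ¬deg2 heads)))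
          rest-of-room
      by-degree (inj₂ ¬deg1) (inj₂ ¬deg2) (inj₂ tails) =
        subst Goal (sym (enter-tails k cr′ vis′ ent′ y ¬deg1 ¬deg2 tails))
          (explore-door-then-resume m k cr′ vis′ ent′ v y (σ G (σ G y)) k≤m enough inside′ exits∉′ room-visited refl
             entry-recorded entry-uncrossed entry-used (org-σσ y)
             (other-doors-unused (σ G (σ G y)) (org-σσ y) ¬deg2))

    explore-door m k cr vis ent z e k≤m enough inside exits∉ z-from unused entry e∉ e≢z e≢αz e-far e-near
      with true-or-false (tgt z ∈ᵇ vis)
    ... | inj₁ z-to = returns (bounce k cr vis ent z e enough exits∉ z-from unused entry e∉ e≢z e≢αz z-to)
    ... | inj₂ z-to with explore-cross m k cr vis ent z k≤m enough inside exits∉ z-from z-to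
    ...   | exits-B rB eq = exits-B rB eq
    ...   | exits-C rC eq = exits-C rC eq
    ...   | halts rB h = halts rB h
    ...   | returns (r , z∈)
      with cross-back (steps r) (crossed r) (visited r) (entries r) z (steps-enough r) (keep-uncrossed r)
                      (return-exitsUnvisited r exits∉) (return-visited r _ z-from) z∈
    ...     | k′ , k≡ , back , enough′ = returns (r′ , used⁺-α (α G z ∷ crossed r) z (∈ᵇ-here (α G z) (crossed r)))
      where
      e-uncrossed : e ∈ᵇ (α G z ∷ crossed r) ≡ false
      e-uncrossed = ∉ᵇ-∷ e (α G z) (crossed r) (e≢αz ∘ sym)
        (subst (λ l → e ∈ᵇ l ≡ false) (sym (crossed≡ r))
          (∉ᵇ-++ e (newly-crossed r) cr (∉ᵇ-All e (newly-crossed r) (newly-crossed-near r) [ e-far , e-near ]′) e∉))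
      r′ : DoorReturn k cr vis ent z e (cross k cr vis ent z)
      r′ = mkReturn k′ (α G z ∷ crossed r) (visited r) (entries r) (α G z ∷ newly-crossed r)
             (trans (continues r) (trans back (cong (resume k′ (α G z ∷ crossed r) (visited r) (entries r))
                                                    (trans (entries-kept r _ z-from) entry))))
             (cong (α G z ∷_) (crossed≡ r))
             (inj₂ (inj₁ refl) ∷ All.map (inj₂ ∘ inj₂) (newly-crossed-near r))
             ((⊆visited r _ (inj₂ (stay z-to)) , subst (λ u → u ∈ᵇ visited r ≡ true) (sym (tgt-α z)) (return-visited r _ z-from))
               ∷ newly-crossed-visited r)
             (visited⊆ r) (⊆visited r) (entries-kept r)
             e-uncrossed enough′ (<⇒≤ (subst (_< k) k≡ (steps-ok r))) (B∉region r) (C∉region r)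

    explore-resume m k cr vis ent v y k≤m enough inside exits∉ v∈ oy entry y∉ y-used
      with true-or-false (used cr (σ G y))
    ... | inj₂ σy-unused =
      subst (λ o → Result HaltInfo (Unexplored cr vis v) o (RoomReturn k cr vis ent v y o)) (sym (resume-σ k cr vis ent y σy-unused))
        (explore-door-then-resume m k cr vis ent v y (σ G y) k≤m enough inside exits∉ v∈ oy entry y∉ y-used
           (trans (σ-org G y) oy) σy-unused)
    ... | inj₁ σy-used with true-or-false (used cr (σ G (σ G y)))
    ...   | inj₂ σσy-unused =
      subst (λ o → Result HaltInfo (Unexplored cr vis v) o (RoomReturn k cr vis ent v y o))
        (sym (resume-σσ k cr vis ent y σy-used σσy-unused))
        (explore-door-then-resume m k cr vis ent v y (σ G (σ G y)) k≤m enough inside exits∉ v∈ oy entry y∉ y-used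
           (trans (org-σσ y) oy) σσy-unused)
    ...   | inj₁ σσy-used =
      returns (mkReturn k cr vis ent [] (resume-back k cr vis ent y σy-used σσy-used) refl [] []
                 (λ w w∈ → inj₁ w∈) (λ w → [ (λ w∈ → w∈) , ⊥-elim ∘ all-doors-used ]′) (λ w w∈ → refl)
                 y∉ enough ≤-refl all-doors-used all-doors-used)
      where
      all-doors-used : ∀ {w} → ¬ Unexplored cr vis v w
      all-doors-used (z , oz , unused , _) with darts-at y z (trans oz (sym oy))
      ... | inj₁ refl = ≡true⇒≢false y-used unused
      ... | inj₂ (inj₁ refl) = ≡true⇒≢false σy-used unused
      ... | inj₂ (inj₂ refl) = ≡true⇒≢false σσy-used unused

    explore-door-then-resume zero k cr vis ent v y z k≤m enough inside exits∉ v∈ oy entry y∉ y-used oz unused =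
      ⊥-elim (no-fuel {y} {cr} y∉ (≤-trans enough k≤m))
    explore-door-then-resume (suc m) k cr vis ent v y z k≤m enough inside exits∉ v∈ oy entry y∉ y-used oz unused =
      door-then-rest {k} {cr} {vis} {ent} {v} {y} {z} oz unused v∈
        (Result-map (λ _ r → r) refl proj₁
          (explore-door (suc m) k cr vis ent z y k≤m enough inside exits∉ (subst (λ u → u ∈ᵇ vis ≡ true) (sym oz) v∈)
             unused (trans (cong ent oz) entry) y∉ y≢z y≢αz y-far y-near))
        (λ r → explore-resume m (steps r) (crossed r) (visited r) (entries r) v y (≤-pred (<-≤-trans (steps-ok r) k≤m))
                 (steps-enough r) (return-crossedInside r inside) (return-exitsUnvisited r exits∉) (return-visited r v v∈) oy
                 (trans (entries-kept r v v∈) entry) (keep-uncrossed r) (return-used r y y-used))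
      where
      y≢z : y ≢ z
      y≢z refl = ≡true⇒≢false y-used unused
      y≢αz : y ≢ α G z
      y≢αz y≡αz = no-loop G z (trans (cong (org G) (sym y≡αz)) (trans oy (sym oz)))
      y-far : ¬ Reach∖ (_∈ᵇ vis) (tgt z) (org G y)
      y-far r = ≡true⇒≢false v∈ (subst (λ u → u ∈ᵇ vis ≡ false) oy (Reach∖-end r))
      y-to : tgt y ∈ᵇ vis ≡ true
      y-to with used⁻ cr y y-used
      ... | inj₁ y∈ = ⊥-elim (≡true⇒≢false y∈ y∉)
      ... | inj₂ αy∈ = proj₁ (inside (α G y) αy∈)
      y-near : ¬ Reach∖ (_∈ᵇ vis) (tgt z) (tgt y)
      y-near r = ≡true⇒≢false y-to (Reach∖-end r)

  a₀ : D
  a₀ = proj₁ (org-surj G (A T))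

  org-a₀ : org G a₀ ≡ A T
  org-a₀ = proj₂ (org-surj G (A T))

  only-door-at-A : ∀ z → org G z ≡ A T → z ≡ a₀
  only-door-at-A z oz with darts-at a₀ z (trans oz (sym org-a₀))
  ... | inj₁ z≡a₀ = z≡a₀
  ... | inj₂ (inj₁ z≡σa₀) = trans z≡σa₀ (degA T a₀ org-a₀)
  ... | inj₂ (inj₂ z≡σσa₀) = trans z≡σσa₀ (trans (cong (σ G) (degA T a₀ org-a₀)) (degA T a₀ org-a₀))

  tgt-a₀≢A : tgt a₀ ≢ A T
  tgt-a₀≢A tgt≡A = no-loop G a₀ (trans tgt≡A (sym org-a₀))

  ∉[A] : ∀ {u} → u ≢ A T → u ∈ᵇ (A T ∷ []) ≡ false
  ∉[A] {u} u≢A = ∉ᵇ-∷ u (A T) [] (u≢A ∘ sym) refl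

  -- A path to X ≢ A that passes through A can be cut to start after A's only door.
  avoid-A : ∀ {u X} → Reach (org G) (α G) u X → X ≢ A T →
            (u ≢ A T → Reach∖ (_∈ᵇ (A T ∷ [])) u X) × (u ≡ A T → Reach∖ (_∈ᵇ (A T ∷ [])) (tgt a₀) X)
  avoid-A here X≢A = (λ u≢A → stay (∉[A] u≢A)) , (⊥-elim ∘ X≢A)
  avoid-A {u} {X} (step z oz r) X≢A = from-other , from-A
    where
    from-other : u ≢ A T → Reach∖ (_∈ᵇ (A T ∷ [])) u X
    from-other u≢A with toSum (tgt z ≟ A T)
    ... | inj₂ tgt≢A = move z (∉[A] u≢A) oz (proj₁ (avoid-A r X≢A) tgt≢A)
    ... | inj₁ tgt≡A = subst (λ t → Reach∖ (_∈ᵇ (A T ∷ [])) t X) tgt-a₀≡u (proj₂ (avoid-A r X≢A) tgt≡A)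
      where
      tgt-a₀≡u : tgt a₀ ≡ u
      tgt-a₀≡u = trans (cong tgt (sym (only-door-at-A (α G z) tgt≡A))) (trans (tgt-α z) oz)
    from-A : u ≡ A T → Reach∖ (_∈ᵇ (A T ∷ [])) (tgt a₀) X
    from-A u≡A = subst (λ t → Reach∖ (_∈ᵇ (A T ∷ [])) (tgt t) X) (only-door-at-A z (trans oz u≡A))
                   (proj₁ (avoid-A r X≢A) (λ tgt≡A → no-loop G z (trans tgt≡A (sym (trans oz u≡A)))))

  reachable-from-a₀ : ∀ X → X ≢ A T → Reach∖ (_∈ᵇ (A T ∷ [])) (tgt a₀) X
  reachable-from-a₀ X X≢A = proj₁ (avoid-A (connected G (tgt a₀) X) X≢A) tgt-a₀≢A

  start-enough : uncrossed [] ≤ 2 * d G + 2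
  start-enough = ≤-trans (countᵇ≤ _) (≤-trans (m≤m+n (d G) (d G + 0)) (m≤m+n _ 2))

  start-inside : CrossedInside [] (A T ∷ [])
  start-inside z ()

  start-exits∉ : ExitsUnvisited (A T ∷ [])
  start-exits∉ = ∉[A] (A≢B T ∘ sym) , ∉[A] (A≢C T ∘ sym)

  start-from : org G a₀ ∈ᵇ (A T ∷ []) ≡ true
  start-from = subst (λ u → u ∈ᵇ (A T ∷ []) ≡ true) (sym org-a₀) (∈ᵇ-here (A T) [])

  dead-end : ∀ {vis v y w} → DegOne G v → org G y ≡ v → tgt y ∈ᵇ vis ≡ true → Reach∖ (_∈ᵇ vis) v w → w ≡ v
  dead-end deg1 oy y-to (stay _) = refl
  dead-end {vis} {v} {y} deg1 oy y-to (move z _ oz r) = ⊥-elim (≡true⇒≢false z-to (Reach∖-start r))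
    where
    σy≡y : σ G y ≡ y
    σy≡y = deg1 y oy
    z≡y : z ≡ y
    z≡y with darts-at y z (trans oz (sym oy))
    ... | inj₁ z≡y = z≡y
    ... | inj₂ (inj₁ z≡σy) = trans z≡σy σy≡y
    ... | inj₂ (inj₂ z≡σσy) = trans z≡σσy (trans (cong (σ G) σy≡y) σy≡y)
    z-to : tgt z ∈ᵇ vis ≡ true
    z-to = subst (λ t → tgt t ∈ᵇ vis ≡ true) (sym z≡y) y-to

  exits-ahead : ∀ {vis x} → org G x ∈ᵇ vis ≡ true →
                Reach∖ (_∈ᵇ vis) (tgt x) (B T) → Reach∖ (_∈ᵇ vis) (tgt x) (C T) → tgt x ≢ B T × tgt x ≢ C T
  exits-ahead {vis} {x} x-from reach-B reach-C = tgt≢B , tgt≢C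
    where
    back-to : tgt (α G x) ∈ᵇ vis ≡ true
    back-to = subst (λ u → u ∈ᵇ vis ≡ true) (sym (tgt-α x)) x-from
    tgt≢B : tgt x ≢ B T
    tgt≢B tgt≡B = B≢C T (sym (trans (dead-end {vis} (subst (DegOne G) (sym tgt≡B) (degB T)) refl back-to reach-C) tgt≡B))
    tgt≢C : tgt x ≢ C T
    tgt≢C tgt≡C = B≢C T (trans (dead-end {vis} (subst (DegOne G) (sym tgt≡C) (degC T)) refl back-to reach-B) tgt≡C)

  data Splits (P Q : V → Set) : Set where
    B-first : P (B T) → ¬ P (C T) → Q (C T) → Splits P Q
    C-first : P (C T) → ¬ P (B T) → Q (B T) → Splits P Q

  Splits-B : ∀ {P Q} → Splits P Q → P (B T) ⊎ Q (B T)
  Splits-B (B-first pB _ _) = inj₁ pB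
  Splits-B (C-first _ _ qB) = inj₂ qB

  Splits-C : ∀ {P Q} → Splits P Q → P (C T) ⊎ Q (C T)
  Splits-C (B-first _ _ qC) = inj₂ qC
  Splits-C (C-first pC _ _) = inj₁ pC

  Splits-swap : ∀ {P a b} → Splits (Reach∖ P a) (Reach∖ P b) → Splits (Reach∖ P b) (Reach∖ P a)
  Splits-swap (B-first aB ¬aC bC) = C-first bC (λ bB → ¬aC (Reach∖-join aB bB bC)) aB
  Splits-swap (C-first aC ¬aB bB) = B-first bB (λ bC → ¬aB (Reach∖-join aC bC bB)) aC

  leave-new-room : ∀ {vis x X} → org G x ∈ᵇ vis ≡ true → Reach∖ (_∈ᵇ vis) (tgt x) X → X ≢ tgt x →
    Σ[ z ∈ D ] (org G z ≡ tgt x × z ≢ α G x × Reach∖ (_∈ᵇ (tgt x ∷ vis)) (tgt z) X)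
  leave-new-room {vis} {x} {X} x-from r X≢tgt with Reach∖-last-exit {vis} (tgt x) r
  ... | inj₁ X≡tgt = ⊥-elim (X≢tgt X≡tgt)
  ... | inj₂ (inj₁ r′) = ⊥-elim (≡true⇒≢false (∈ᵇ-here (tgt x) vis) (Reach∖-start r′))
  ... | inj₂ (inj₂ (z , oz , r′)) = z , oz , z≢αx , r′
    where
    z≢αx : z ≢ α G x
    z≢αx refl = ≡true⇒≢false (∈ᵇ-there _ (tgt x) vis (subst (λ u → u ∈ᵇ vis ≡ true) (sym (tgt-α x)) x-from))
                             (Reach∖-start r′)

  module Separation (reach? : ∀ (P : V → Bool) u w → Dec (Reach∖ P u w)) where

    Branch : List V → V → D → V → Set
    Branch vis v z = Reach∖ (_∈ᵇ (v ∷ vis)) (tgt z)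

    Separating : List V → V → D → Set
    Separating vis v y = σ G y ≢ y × σ G (σ G y) ≢ y × Splits (Branch vis v (σ G y)) (Branch vis v (σ G (σ G y)))

    separating? : ∀ vis v y → Dec (Separating vis v y)
    separating? vis v y = ¬? (σ G y ≟ y) ×-dec ¬? (σ G (σ G y) ≟ y) ×-dec splits?
      where
      branch? : ∀ z X → Dec (Branch vis v z X)
      branch? z X = reach? (_∈ᵇ (v ∷ vis)) (tgt z) X
      P : V → Set
      P = Branch vis v (σ G y)
      Q : V → Set
      Q = Branch vis v (σ G (σ G y))
      from : Splits P Q → (P (B T) × ¬ P (C T) × Q (C T)) ⊎ (P (C T) × ¬ P (B T) × Q (B T))
      from (B-first p ¬p q) = inj₁ (p , ¬p , q)
      from (C-first p ¬p q) = inj₂ (p , ¬p , q)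
      splits? : Dec (Splits P Q)
      splits? = map′ [ (λ (p , ¬p , q) → B-first p ¬p q) , (λ (p , ¬p , q) → C-first p ¬p q) ]′ from
        ((branch? (σ G y) (B T) ×-dec ¬? (branch? (σ G y) (C T)) ×-dec branch? (σ G (σ G y)) (C T)) ⊎-dec
         (branch? (σ G y) (C T) ×-dec ¬? (branch? (σ G y) (B T)) ×-dec branch? (σ G (σ G y)) (B T)))

    stopAtSeparation : StopRule
    stopAtSeparation vis v y = ⌊ separating? vis v y ⌋

    separation-reaches-B : ∀ vs v y → v ∈ᵇ vs ≡ false → org G y ≡ v → stopAtSeparation vs v y ≡ true →
                           Reach∖ (_∈ᵇ vs) v (B T)
    separation-reaches-B vs v y v∉ oy stops with ⌊⌋-true⁻ (separating? vs v y) stops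
    ... | _ , _ , B-first rB _ _ =
      move (σ G y) v∉ (trans (σ-org G y) oy) (Reach∖-mono (λ u u∈ → ∈ᵇ-there u v vs u∈) rB)
    ... | _ , _ , C-first _ _ rB =
      move (σ G (σ G y)) v∉ (trans (org-σσ y) oy) (Reach∖-mono (λ u u∈ → ∈ᵇ-there u v vs u∈) rB)

    record SeparationHalt (k : ℕ) (cr : List D) (vis : List V) (x : D) : Set where
      constructor mkSeparationHalt
      field
        enough : uncrossed cr ≤ k
        inside : CrossedInside cr vis
        exits∉ : ExitsUnvisited vis
        x-from : org G x ∈ᵇ vis ≡ true
        x-to : tgt x ∈ᵇ vis ≡ false
        separating : Separating vis (tgt x) (α G x)

    B-first? : ∀ {P Q} → Splits P Q → Bool
    B-first? (B-first _ _ _) = true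
    B-first? (C-first _ _ _) = false

    -- heads sends the walker into the σ-branch first
    exit-for : (heads : Bool) (B-first : Bool) → Exit
    exit-for true true = exitB
    exit-for true false = exitC
    exit-for false true = exitC
    exit-for false false = exitB

    direction : ∀ {k cr vis x} → SeparationHalt k cr vis x → Bool
    direction h = B-first? (proj₂ (proj₂ (SeparationHalt.separating h)))

    HaltsAtSeparation : Outcome → Set
    HaltsAtSeparation o = Σ[ k ∈ ℕ ] Σ[ cr ∈ List D ] Σ[ vis ∈ List V ] Σ[ ent ∈ (V → Maybe D) ] Σ[ x ∈ D ]
                            (o ≡ halted k cr vis ent x × SeparationHalt k cr vis x)

    module ToSeparation (coin : V → Bool) where
      open Walker stopAtSeparation coin
      open Explore stopAtSeparation coin separation-reaches-B

      record DoorOrder (vis : List V) (y : D) : Set where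
        field
          first second : D
          first-at : org G first ≡ org G y
          second-at : org G second ≡ org G y
          first≢y : first ≢ y
          second≢y : second ≢ y
          only-doors : ∀ z → org G z ≡ org G y → z ≡ y ⊎ z ≡ first ⊎ z ≡ second
          separating : Splits (Branch vis (org G y) first) (Branch vis (org G y) second) → Separating vis (org G y) y
          then-second : ∀ k cr vis′ ent → used cr first ≡ true → used cr second ≡ false →
                        resume k cr vis′ ent (just y) ≡ cross k cr vis′ ent second

      heads-order : ∀ vis y → σ G y ≢ y → σ G (σ G y) ≢ y → DoorOrder vis y
      heads-order vis y ¬deg1 ¬deg2 = record
        { first = σ G y ; second = σ G (σ G y) ; first-at = σ-org G y ; second-at = org-σσ y
        ; first≢y = ¬deg1 ; second≢y = ¬deg2 ; only-doors = darts-at y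
        ; separating = λ splits → ¬deg1 , ¬deg2 , splits
        ; then-second = λ k cr vis′ ent → resume-σσ k cr vis′ ent y }

      tails-order : ∀ vis y → σ G y ≢ y → σ G (σ G y) ≢ y → DoorOrder vis y
      tails-order vis y ¬deg1 ¬deg2 = record
        { first = σ G (σ G y) ; second = σ G y ; first-at = org-σσ y ; second-at = σ-org G y
        ; first≢y = ¬deg2 ; second≢y = ¬deg1 ; only-doors = swapped
        ; separating = λ splits → ¬deg1 , ¬deg2 , Splits-swap splits
        ; then-second = λ k cr vis′ ent _ σy-unused → resume-σ k cr vis′ ent y σy-unused }
        where
        swapped : ∀ z → org G z ≡ org G y → z ≡ y ⊎ z ≡ σ G (σ G y) ⊎ z ≡ σ G y
        swapped z oz with darts-at y z oz
        ... | inj₁ z≡y = inj₁ z≡y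
        ... | inj₂ (inj₁ z≡σy) = inj₂ (inj₂ z≡σy)
        ... | inj₂ (inj₂ z≡σσy) = inj₂ (inj₁ z≡σσy)

      ReachesSeparation : ℕ → ℕ → List D → List V → (V → Maybe D) → D → Set
      ReachesSeparation m k cr vis ent x = k ≤ m → uncrossed cr ≤ k → CrossedInside cr vis → ExitsUnvisited vis →
        org G x ∈ᵇ vis ≡ true → tgt x ∈ᵇ vis ≡ false →
        Reach∖ (_∈ᵇ vis) (tgt x) (B T) → Reach∖ (_∈ᵇ vis) (tgt x) (C T) → HaltsAtSeparation (cross k cr vis ent x)

      -- In a non-separating three-door room either the first branch leads to both exits, or
      -- to neither; then it is explored completely and both exits lie beyond the second door.
      three-doors : ∀ m k cr vis ent x → (∀ k cr vis ent x → ReachesSeparation m k cr vis ent x) →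
        k ≤ m → uncrossed (x ∷ cr) ≤ k → CrossedInside cr vis → ExitsUnvisited vis →
        org G x ∈ᵇ vis ≡ true → tgt x ∈ᵇ vis ≡ false →
        Reach∖ (_∈ᵇ vis) (tgt x) (B T) → Reach∖ (_∈ᵇ vis) (tgt x) (C T) → tgt x ≢ B T → tgt x ≢ C T →
        ¬ Separating vis (tgt x) (α G x) → (order : DoorOrder vis (α G x)) →
        HaltsAtSeparation (cross k (x ∷ cr) (tgt x ∷ vis) (setEntry ent (tgt x) (α G x)) (DoorOrder.first order))
      three-doors m k cr vis ent x IH k≤m enough inside exits∉ x-from x-to reach-B reach-C tgt≢B tgt≢C ¬sep order =
        by-first-branch (toSum (reach? (_∈ᵇ vis′) (tgt first) (B T))) (toSum (reach? (_∈ᵇ vis′) (tgt first) (C T)))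
        where
        open DoorOrder order
        open Entering {cr} {vis} {ent} {x} inside x-from x-to
        exits∉′ : ExitsUnvisited vis′
        exits∉′ = exits-still-unvisited exits∉ tgt≢B tgt≢C
        beyond-second : ∀ X → Reach∖ (_∈ᵇ vis) v X → X ≢ v → ¬ Branch vis v first X → Branch vis v second X
        beyond-second X r X≢v ¬first with leave-new-room {vis} {x} x-from r X≢v
        ... | z , oz , z≢y , r′ with only-doors z oz
        ...   | inj₁ z≡y = ⊥-elim (z≢y z≡y)
        ...   | inj₂ (inj₁ refl) = ⊥-elim (¬first r′)
        ...   | inj₂ (inj₂ refl) = r′
        B-beyond-second : ¬ Branch vis v first (B T) → Branch vis v second (B T)
        B-beyond-second = beyond-second (B T) reach-B (tgt≢B ∘ sym)
        C-beyond-second : ¬ Branch vis v first (C T) → Branch vis v second (C T)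
        C-beyond-second = beyond-second (C T) reach-C (tgt≢C ∘ sym)

        by-first-branch : Branch vis v first (B T) ⊎ ¬ Branch vis v first (B T) →
                          Branch vis v first (C T) ⊎ ¬ Branch vis v first (C T) →
                          HaltsAtSeparation (cross k cr′ vis′ ent′ first)
        by-first-branch (inj₁ first-B) (inj₁ first-C) =
          IH k cr′ vis′ ent′ first k≤m enough inside′ exits∉′ (door-from first-at) (Reach∖-start first-B) first-B first-C
        by-first-branch (inj₁ first-B) (inj₂ ¬first-C) = ⊥-elim (¬sep (separating (B-first first-B ¬first-C (C-beyond-second ¬first-C))))
        by-first-branch (inj₂ ¬first-B) (inj₁ first-C) = ⊥-elim (¬sep (separating (C-first first-C ¬first-B (B-beyond-second ¬first-B))))
        by-first-branch (inj₂ ¬first-B) (inj₂ ¬first-C) =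
          after-first (explore-door m k cr′ vis′ ent′ first y k≤m enough inside′ exits∉′ (door-from first-at)
                         (other-doors-unused first first-at first≢y) (trans (cong ent′ first-at) entry-recorded)
                         entry-uncrossed (first≢y ∘ sym) y≢αfirst y-far y-near)
          where
          y≢αfirst : y ≢ α G first
          y≢αfirst y≡αfirst = no-loop G first (trans (cong (org G) (sym y≡αfirst)) (sym first-at))
          y-far : ¬ Branch vis v first (org G y)
          y-far r = ≡true⇒≢false room-visited (Reach∖-end r)
          y-near : ¬ Branch vis v first (tgt y)
          y-near r = ≡true⇒≢false (∈ᵇ-there _ v vis back-room-visited) (Reach∖-end r)
          after-first : Result HaltInfo (Branch vis v first) (cross k cr′ vis′ ent′ first)
                          (Σ (DoorReturn k cr′ vis′ ent′ first y (cross k cr′ vis′ ent′ first))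
                             (λ r → used (crossed r) first ≡ true)) →
                        HaltsAtSeparation (cross k cr′ vis′ ent′ first)
          after-first (exits-B first-B _) = ⊥-elim (¬first-B first-B)
          after-first (exits-C first-C _) = ⊥-elim (¬first-C first-C)
          after-first (halts first-B _) = ⊥-elim (¬first-B first-B)
          after-first (returns (r , first-used)) =
            subst HaltsAtSeparation
              (sym (trans (continues r) (then-second (steps r) (crossed r) (visited r) (entries r) first-used
                                                     (proj₁ (still-beyond-second (B T) B-beyond-second ¬first-B)))))
              (IH (steps r) (crossed r) (visited r) (entries r) second (≤-trans (<⇒≤ (steps-ok r)) k≤m) (steps-enough r)
                  (return-crossedInside r inside′) (return-exitsUnvisited r exits∉′) (return-visited r _ (door-from second-at))
                  (Reach∖-start (proj₂ (still-beyond-second (B T) B-beyond-second ¬first-B)))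
                  (proj₂ (still-beyond-second (B T) B-beyond-second ¬first-B))
                  (proj₂ (still-beyond-second (C T) C-beyond-second ¬first-C)))
            where
            still-beyond-second : ∀ X → (¬ Branch vis v first X → Branch vis v second X) → ¬ Branch vis v first X →
                                  used (crossed r) second ≡ false × Reach∖ (_∈ᵇ visited r) (tgt second) X
            still-beyond-second X beyond ¬first
              with Unexplored-split r first-at room-visited X
                     (second , second-at , other-doors-unused second second-at second≢y , beyond ¬first)
            ... | inj₁ r-first = ⊥-elim (¬first r-first)
            ... | inj₂ (z , oz , unused , r′) with only-doors z oz
            ...   | inj₁ refl = ⊥-elim (≡true⇒≢false (return-used r y entry-used) unused)
            ...   | inj₂ (inj₁ refl) = ⊥-elim (≡true⇒≢false first-used unused)
            ...   | inj₂ (inj₂ refl) = unused , r′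

      reach-separation : ∀ m k cr vis ent x → ReachesSeparation m k cr vis ent x
      reach-separation zero k cr vis ent x k≤m enough inside exits∉ x-from x-to reach-B reach-C =
        ⊥-elim (no-fuel {x} {cr} (into-unvisited-uncrossed {cr} {vis} {x} inside x-to) (≤-trans enough k≤m))
      reach-separation (suc m) zero cr vis ent x k≤m enough inside exits∉ x-from x-to reach-B reach-C =
        ⊥-elim (no-fuel {x} {cr} (into-unvisited-uncrossed {cr} {vis} {x} inside x-to) enough)
      reach-separation (suc m) (suc k) cr vis ent x k≤m enough inside exits∉ x-from x-to reach-B reach-C
        with true-or-false (stopAtSeparation vis (tgt x) (α G x))
      ... | inj₁ stops =
        let (tgt≢B , tgt≢C) = exits-ahead {vis} {x} x-from reach-B reach-C in
        suc k , cr , vis , ent , x , cross-halt k cr vis ent x tgt≢B tgt≢C x-to stops ,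
        mkSeparationHalt enough inside exits∉ x-from x-to (⌊⌋-true⁻ (separating? vis (tgt x) (α G x)) stops)
      ... | inj₂ goes-on =
        subst HaltsAtSeparation (sym (cross-new k cr vis ent x tgt≢B tgt≢C x-to goes-on))
          (by-degree (toSum (σ G y ≟ y)) (toSum (σ G (σ G y) ≟ y)) (true-or-false (coin v)))
        where
        open Entering {cr} {vis} {ent} {x} inside x-from x-to
        tgt≢B : v ≢ B T
        tgt≢B = proj₁ (exits-ahead {vis} {x} x-from reach-B reach-C)
        tgt≢C : v ≢ C T
        tgt≢C = proj₂ (exits-ahead {vis} {x} x-from reach-B reach-C)
        ¬sep : ¬ Separating vis v y
        ¬sep = ⌊⌋-false⁻ (separating? vis v y) goes-on
        B-door : Σ[ z ∈ D ] (org G z ≡ v × z ≢ y × Reach∖ (_∈ᵇ vis′) (tgt z) (B T))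
        B-door = leave-new-room {vis} {x} x-from reach-B (tgt≢B ∘ sym)
        only-σ-door : ∀ {X} → σ G (σ G y) ≡ y → Σ[ z ∈ D ] (org G z ≡ v × z ≢ y × Reach∖ (_∈ᵇ vis′) (tgt z) X) →
                      Reach∖ (_∈ᵇ vis′) (tgt (σ G y)) X
        only-σ-door deg2 (z , oz , z≢y , r) with darts-at y z oz
        ... | inj₁ z≡y = ⊥-elim (z≢y z≡y)
        ... | inj₂ (inj₁ refl) = r
        ... | inj₂ (inj₂ z≡σσy) = ⊥-elim (z≢y (trans z≡σσy deg2))
        by-degree : σ G y ≡ y ⊎ σ G y ≢ y → σ G (σ G y) ≡ y ⊎ σ G (σ G y) ≢ y → coin v ≡ true ⊎ coin v ≡ false →
                    HaltsAtSeparation (enter k cr′ vis′ ent′ y)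
        by-degree (inj₁ deg1) _ _ with B-door
        ... | z , oz , z≢y , _ = ⊥-elim (z≢y (dead-end-door (darts-at y z oz)))
          where
          dead-end-door : z ≡ y ⊎ z ≡ σ G y ⊎ z ≡ σ G (σ G y) → z ≡ y
          dead-end-door (inj₁ z≡y) = z≡y
          dead-end-door (inj₂ (inj₁ z≡σy)) = trans z≡σy deg1
          dead-end-door (inj₂ (inj₂ z≡σσy)) = trans z≡σσy (trans (cong (σ G) deg1) deg1)
        by-degree (inj₂ ¬deg1) (inj₁ deg2) _ =
          subst HaltsAtSeparation (sym (enter-deg2 k cr′ vis′ ent′ y ¬deg1 deg2))
            (reach-separation m k cr′ vis′ ent′ (σ G y) (≤-pred k≤m) (enough′ enough) inside′
              (exits-still-unvisited exits∉ tgt≢B tgt≢C)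
              (subst (λ u → u ∈ᵇ vis′ ≡ true) (sym (σ-org G y)) room-visited)
              (Reach∖-start (only-σ-door deg2 B-door)) (only-σ-door deg2 B-door)
              (only-σ-door deg2 (leave-new-room {vis} {x} x-from reach-C (tgt≢C ∘ sym))))
        by-degree (inj₂ ¬deg1) (inj₂ ¬deg2) (inj₁ heads) =
          subst HaltsAtSeparation (sym (enter-heads k cr′ vis′ ent′ y ¬deg1 ¬deg2 heads))
            (three-doors m k cr vis ent x (reach-separation m) (≤-pred k≤m) (enough′ enough) inside exits∉ x-from x-to
               reach-B reach-C tgt≢B tgt≢C ¬sep (heads-order vis y ¬deg1 ¬deg2))
        by-degree (inj₂ ¬deg1) (inj₂ ¬deg2) (inj₂ tails) =
          subst HaltsAtSeparation (sym (enter-tails k cr′ vis′ ent′ y ¬deg1 ¬deg2 tails))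
            (three-doors m k cr vis ent x (reach-separation m) (≤-pred k≤m) (enough′ enough) inside exits∉ x-from x-to
               reach-B reach-C tgt≢B tgt≢C ¬sep (tails-order vis y ¬deg1 ¬deg2))

    module FromSeparation (coin : V → Bool) where
      open Walker neverStop coin
      open Explore neverStop coin (λ _ _ _ _ _ ())

      module _ {R o cr vis ent Near keep StepsOk next} {Q : Return cr vis ent R Near keep StepsOk next o → Set} where

        exits-at-B : Result HaltInfo R o (Σ (Return cr vis ent R Near keep StepsOk next o) Q) →
                     R (B T) → ¬ R (C T) → o ≡ exit exitB
        exits-at-B (exits-B _ eq) _ _ = eq
        exits-at-B (exits-C rC _) _ ¬rC = ⊥-elim (¬rC rC)
        exits-at-B (halts _ (_ , _ , _ , ())) _ _
        exits-at-B (returns (r , _)) rB _ = ⊥-elim (B∉region r rB)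

        exits-at-C : Result HaltInfo R o (Σ (Return cr vis ent R Near keep StepsOk next o) Q) →
                     R (C T) → ¬ R (B T) → o ≡ exit exitC
        exits-at-C (exits-B rB _) _ ¬rB = ⊥-elim (¬rB rB)
        exits-at-C (exits-C _ eq) _ _ = eq
        exits-at-C (halts rB _) _ ¬rB = ⊥-elim (¬rB rB)
        exits-at-C (returns (r , _)) rC _ = ⊥-elim (C∉region r rC)

      exit-at-separation : ∀ k cr vis ent x (h : SeparationHalt k cr vis x) →
                           cross k cr vis ent x ≡ exit (exit-for (coin (tgt x)) (direction h))
      exit-at-separation zero cr vis ent x h =
        ⊥-elim (no-fuel {x} {cr} (into-unvisited-uncrossed {cr} {vis} {x} (SeparationHalt.inside h) (SeparationHalt.x-to h))
                        (SeparationHalt.enough h))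
      exit-at-separation (suc k) cr vis ent x (mkSeparationHalt enough inside exits∉ x-from x-to (¬deg1 , ¬deg2 , splits)) =
        trans (cross-new k cr vis ent x tgt≢B tgt≢C x-to refl) (by-coin splits (coin v) refl)
        where
        open Entering {cr} {vis} {ent} {x} inside x-from x-to
        branch-end : ∀ {z X} → Branch vis v z X → v ≢ X
        branch-end {X = X} r v≡X = ≡true⇒≢false (subst (λ u → u ∈ᵇ vis′ ≡ true) v≡X room-visited) (Reach∖-end r)
        tgt≢B : v ≢ B T
        tgt≢B = [ branch-end , branch-end ]′ (Splits-B splits)
        tgt≢C : v ≢ C T
        tgt≢C = [ branch-end , branch-end ]′ (Splits-C splits)
        explore-branch : ∀ z → org G z ≡ v → ∀ {X} → Branch vis v z X →
          Result HaltInfo (Branch vis v z) (cross k cr′ vis′ ent′ z) (CrossReturn k cr′ vis′ ent′ z (cross k cr′ vis′ ent′ z))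
        explore-branch z oz r =
          explore-cross k k cr′ vis′ ent′ z ≤-refl (enough′ enough) inside′ (exits-still-unvisited exits∉ tgt≢B tgt≢C)
            (subst (λ u → u ∈ᵇ vis′ ≡ true) (sym oz) room-visited) (Reach∖-start r)
        by-coin : (s : Splits (Branch vis v (σ G y)) (Branch vis v (σ G (σ G y)))) → ∀ c → coin v ≡ c →
                  enter k cr′ vis′ ent′ y ≡ exit (exit-for c (B-first? s))
        by-coin (B-first σB ¬σC σσC) true heads =
          trans (enter-heads k cr′ vis′ ent′ y ¬deg1 ¬deg2 heads) (exits-at-B (explore-branch (σ G y) (σ-org G y) σB) σB ¬σC)
        by-coin (B-first σB ¬σC σσC) false tails =
          trans (enter-tails k cr′ vis′ ent′ y ¬deg1 ¬deg2 tails)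
                (exits-at-C (explore-branch (σ G (σ G y)) (org-σσ y) σσC) σσC (λ σσB → ¬σC (Reach∖-join σB σσB σσC)))
        by-coin (C-first σC ¬σB σσB) true heads =
          trans (enter-heads k cr′ vis′ ent′ y ¬deg1 ¬deg2 heads) (exits-at-C (explore-branch (σ G y) (σ-org G y) σC) σC ¬σB)
        by-coin (C-first σC ¬σB σσB) false tails =
          trans (enter-tails k cr′ vis′ ent′ y ¬deg1 ¬deg2 tails)
                (exits-at-B (explore-branch (σ G (σ G y)) (org-σσ y) σσB) σσB (λ σσC → ¬σB (Reach∖-join σC σσC σσB)))

    start : StopRule → (V → Bool) → Outcome
    start stop coin = Walker.cross stop coin (2 * d G + 2) [] (A T ∷ []) (λ _ → nothing) a₀

    start-halts : ∀ coin → HaltsAtSeparation (start stopAtSeparation coin)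
    start-halts coin =
      ToSeparation.reach-separation coin (2 * d G + 2) (2 * d G + 2) [] (A T ∷ []) (λ _ → nothing) a₀ ≤-refl
        start-enough start-inside start-exits∉ start-from (∉[A] tgt-a₀≢A)
        (reachable-from-a₀ (B T) (A≢B T ∘ sym)) (reachable-from-a₀ (C T) (A≢C T ∘ sym))

    -- the other outcomes never occur, by start-halts
    halting-room : Outcome → V
    halting-room (halted _ _ _ _ x) = tgt x
    halting-room _ = A T

    separation-room : Vec Bool (n G) → V
    separation-room cs = halting-room (start stopAtSeparation (lookup cs))

    pdfs : Vec Bool (n G) → Maybe Exit
    pdfs cs = pdfsExit G T (lookup cs)

    pdfs-from-separation : ∀ coin {k cr vis ent x} → start stopAtSeparation coin ≡ halted k cr vis ent x →
                           (h : SeparationHalt k cr vis x) → pdfsExit G T coin ≡ just (exit-for (coin (tgt x)) (direction h))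
    pdfs-from-separation coin {k} {cr} {vis} {ent} {x} stops-there h = begin
      pdfsExit G T coin
        ≡⟨ run-is-cross coin (2 * d G + 2) [] (A T ∷ []) (λ _ → nothing) a₀ ⟩
      outcome-exit (start neverStop coin)
        ≡⟨ cong outcome-exit (proj₁ (retrace-cross (2 * d G + 2) [] (A T ∷ []) (λ _ → nothing) a₀ stops-there (λ _ _ → refl))) ⟩
      outcome-exit (Walker.cross neverStop coin k cr vis ent x)
        ≡⟨ cong outcome-exit (FromSeparation.exit-at-separation coin k cr vis ent x h) ⟩
      just (exit-for (coin (tgt x)) (direction h))
        ∎
      where
      open ≡-Reasoning
      open Simulation stopAtSeparation coin neverStop coin (λ _ _ _ _ → refl) (Walker.cross neverStop coin)
                      (λ _ _ _ _ _ _ _ _ _ → refl)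

    record FlippingTheDecisiveCoin (cs : Vec Bool (n G)) : Set where
      field
        dir : Bool
        same-room : separation-room (flipAt (separation-room cs) cs) ≡ separation-room cs
        exit-before : pdfs cs ≡ just (exit-for (lookup cs (separation-room cs)) dir)
        exit-after : pdfs (flipAt (separation-room cs) cs) ≡ just (exit-for (not (lookup cs (separation-room cs))) dir)

    -- The walk up to the separating room s tosses only coins of rooms visited before s.
    flipping-the-decisive-coin : ∀ cs → FlippingTheDecisiveCoin cs
    flipping-the-decisive-coin cs with start-halts (lookup cs)
    ... | k , cr , vis , ent , x , stops-there , h = record
      { dir = direction h
      ; same-room = trans (cong halting-room stops-there′) (sym s≡)
      ; exit-before = trans (pdfs-from-separation (lookup cs) stops-there h)
                            (cong (λ t → just (exit-for (lookup cs t) (direction h))) (sym s≡))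
      ; exit-after = trans (pdfs-from-separation (lookup cs′) stops-there′ h)
                           (cong (λ b → just (exit-for b (direction h)))
                                 (trans (cong (lookup cs′) (sym s≡)) (lookup∘updateAt (separation-room cs) cs)))
      }
      where
      s≡ : separation-room cs ≡ tgt x
      s≡ = cong halting-room stops-there
      cs′ : Vec Bool (n G)
      cs′ = flipAt (separation-room cs) cs
      agree : ∀ w → w ∈ᵇ vis ≡ true → lookup cs w ≡ lookup cs′ w
      agree w w∈ = sym (lookup∘updateAt′ w (separation-room cs) w≢s cs)
        where
        w≢s : w ≢ separation-room cs
        w≢s w≡s = visited≢unvisited {vis} w∈ (SeparationHalt.x-to h) (trans w≡s s≡)
      open Simulation stopAtSeparation (lookup cs) stopAtSeparation (lookup cs′) (λ _ _ _ → id) halted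
                      (Walker.cross-halt stopAtSeparation (lookup cs′))
      stops-there′ : start stopAtSeparation (lookup cs′) ≡ halted k cr vis ent x
      stops-there′ = proj₁ (retrace-cross (2 * d G + 2) [] (A T ∷ []) (λ _ → nothing) a₀ stops-there agree)

    exit-for-flipped : ∀ b dir → isExit exitB (just (exit-for (not b) dir)) ≡ isExit exitC (just (exit-for b dir))
    exit-for-flipped true true = refl
    exit-for-flipped true false = refl
    exit-for-flipped false true = refl
    exit-for-flipped false false = refl

    isExit-B-or-C : ∀ e → isExit exitB (just e) ≡ not (isExit exitC (just e))
    isExit-B-or-C exitB = refl
    isExit-B-or-C exitC = refl

    exits-equally-often : 2 * countExit G T exitB ≡ 2 ^ n G × 2 * countExit G T exitC ≡ 2 ^ n G
    exits-equally-often =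
      decisive-coin-halves (n G) separation-room (isExit exitB ∘ pdfs) (isExit exitC ∘ pdfs)
        (same-room ∘ flipping-the-decisive-coin) swapped complementary
      where
      open FlippingTheDecisiveCoin
      swapped : ∀ cs → isExit exitB (pdfs (flipAt (separation-room cs) cs)) ≡ isExit exitC (pdfs cs)
      swapped cs = begin
        isExit exitB (pdfs (flipAt (separation-room cs) cs))      ≡⟨ cong (isExit exitB) (exit-after F) ⟩
        isExit exitB (just (exit-for (not decisive) (dir F)))     ≡⟨ exit-for-flipped decisive (dir F) ⟩
        isExit exitC (just (exit-for decisive (dir F)))           ≡⟨ cong (isExit exitC) (exit-before F) ⟨
        isExit exitC (pdfs cs)                                    ∎
        where
        open ≡-Reasoning
        F : FlippingTheDecisiveCoin cs
        F = flipping-the-decisive-coin cs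
        decisive : Bool
        decisive = lookup cs (separation-room cs)
      complementary : ∀ cs → isExit exitB (pdfs cs) ≡ not (isExit exitC (pdfs cs))
      complementary cs rewrite exit-before (flipping-the-decisive-coin cs) = isExit-B-or-C _

  reachability-decidable : ¬ ¬ (∀ (P : V → Bool) u w → Dec (Reach∖ P u w))
  reachability-decidable =
    ¬¬-map (λ dec P u w → map′ (to P) (from P) (dec (tabulate P) u w))
      (¬¬-∀-listed (allCoins (n G)) (∈-allCoins (n G)) λ c →
         ¬¬-∀-listed (allFin (n G)) ∈-allFin λ u →
           ¬¬-∀-listed (allFin (n G)) ∈-allFin λ w → ¬¬-excluded-middle {A = Reach∖ (lookup c) u w})
    where
    to : ∀ P {u w} → Reach∖ (lookup (tabulate P)) u w → Reach∖ P u w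
    to P = Reach∖-mono (λ v Pv → trans (lookup∘tabulate P v) Pv)
    from : ∀ P {u w} → Reach∖ P u w → Reach∖ (lookup (tabulate P)) u w
    from P = Reach∖-mono (λ v Pv → trans (sym (lookup∘tabulate P v)) Pv)

-- The statement is decidable, so classical decidability of reachability may be assumed.
mainTheorem1 : (G : PlaneGraph) (T : Terminals G) →
    2 * countExit G T exitB ≡ 2 ^ n G × 2 * countExit G T exitC ≡ 2 ^ n G
mainTheorem1 G T =
  decidable-stable ((2 * countExit G T exitB ≟ℕ 2 ^ n G) ×-dec (2 * countExit G T exitC ≟ℕ 2 ^ n G))
    (¬¬-map (Maze.Separation.exits-equally-often G T) (Maze.reachability-decidable G T))
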